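{- If $F$ is a finite forest, then $\varepsilon(F)$ is pancyclic.
   Context: A dominating set of a graph $G$ is a set $D\subseteq V(G)$ such that every vertex of $V(G)\setminus D$ has a neighbour in $D$. The TARS-graph $\varepsilon(G)$ has as vertices the dominating sets of $G$; two distinct dominating sets $X,Y$ are adjacent iff either (i) $Y$ is obtained from $X$ by adding or deleting a single vertex of $G$, or (ii) there are vertices $u\in X$ and $v\in Y\setminus X$ that are adjacent in $G$ with $Y=(X\cup\{v\})\setminus\{u\}$. A graph on $N$ vertices is pancyclic if it contains a cycle of length $\ell$ for every integer $\ell$ with $3\le \ell\le N$ (vacuously true if $N\le 2$). -}

module Defs where

open import Data.Nat using (ℕ; zero; suc; NonZero)
open import Data.Nat.DivMod using (_mod_)
open import Data.Fin using (Fin; toℕ)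
open import Data.Fin.Properties using (any?; all?)
open import Data.Fin.Subset using (Subset; _∈_; _∉_; _∪_; _-_; ⁅_⁆)
open import Data.Fin.Subset.Properties using (_∈?_)
open import Data.Bool using (true; false)
open import Data.Vec using ([]; _∷_)
open import Data.List using (List; []; _∷_; _++_; map; filter; length)
open import Data.Product using (Σ; ∃; ∃-syntax; _×_; _,_)
open import Data.Sum using (_⊎_; inj₁; inj₂)
open import Data.Unit using (⊤)
open import Relation.Nullary using (¬_; Dec; yes; no)
open import Relation.Nullary.Decidable using (_×-dec_; _⊎-dec_)
open import Relation.Binary.PropositionalEquality using (_≡_)
open import Function.Definitions using (Injective)

record Graph : Set₁ where
  field
    n     : ℕ
    Adj   : Fin n → Fin n → Set
    adj?  : ∀ u v → Dec (Adj u v)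
    sym   : ∀ {u v} → Adj u v → Adj v u
    irrefl : ∀ {u} → ¬ Adj u u

next : ∀ {ℓ} → Fin ℓ → Fin ℓ
next {suc k} i = suc (toℕ i) mod (suc k)

record Cycle {A : Set} (P : A → Set) (R : A → A → Set) (ℓ : ℕ) : Set where
  field
    vert  : Fin ℓ → A
    inP   : ∀ i → P (vert i)
    inj   : Injective _≡_ _≡_ vert
    step  : ∀ i → R (vert i) (vert (next i))

Pancyclic : {A : Set} (P : A → Set) (R : A → A → Set) (N : ℕ) → Set
Pancyclic P R N = ∀ ℓ → 3 Data.Nat.≤ ℓ → ℓ Data.Nat.≤ N → Cycle P R ℓ

IsForest : Graph → Set
IsForest G = ∀ ℓ → 3 Data.Nat.≤ ℓ → ¬ Cycle {Fin (Graph.n G)} (λ _ → ⊤) (Graph.Adj G) ℓ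

module _ (G : Graph) where
  open Graph G

  Dominating : Subset n → Set
  Dominating D = ∀ v → v ∉ D → ∃[ u ] (u ∈ D × Adj u v)

  TARSAdj : Subset n → Subset n → Set
  TARSAdj X Y =
      (∃[ v ] (v ∉ X × Y ≡ X ∪ ⁅ v ⁆))
    ⊎ (∃[ v ] (v ∈ X × Y ≡ X - v))
    ⊎ (∃[ u ] ∃[ v ] (u ∈ X × v ∈ Y × v ∉ X × Adj u v
                       × Y ≡ (X ∪ ⁅ v ⁆) - u))

  dominating? : ∀ D → Dec (Dominating D)
  dominating? D = all? (λ v → helper v)
    where
      helper : ∀ v → Dec (v ∉ D → ∃[ u ] (u ∈ D × Adj u v))
      helper v with v ∈? D | any? (λ u → (u ∈? D) ×-dec adj? u v)
      ... | yes v∈D | _ = yes (λ v∉D → Relation.Nullary.contradiction v∈D v∉D)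
      ... | no _ | yes e = yes (λ _ → e)
      ... | no v∉D | no ¬e = no (λ f → ¬e (f v∉D))

allSubsets : (n : ℕ) → List (Subset n)
allSubsets zero = [] ∷ []
allSubsets (suc n) = map (true ∷_) (allSubsets n) ++ map (false ∷_) (allSubsets n)

-- number of vertices of ε(G) = number of dominating sets of G
numDominating : Graph → ℕ
numDominating G = length (filter (dominating? G) (allSubsets (Graph.n G)))

TARSPancyclic : Graph → Set
TARSPancyclic G = Pancyclic (Dominating G) (TARSAdj G) (numDominating G)

{-# OPTIONS --safe #-}

-- A forest with an edge has a pendant edge xy. Split a dominating set S into its bits at x and y
-- and its core S ∖ {x, y}. The sets containing y are a ∪ {y} and a ∪ {x, y}, where the core a
-- ranges over the family P of subsets of V ∖ {x, y} dominating every vertex outside {x, y} ∪ N(y);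
-- the sets avoiding y are a ∪ {x}, where a ranges over the subfamily Q of P of cores dominating all
-- of V ∖ {x, y}. So ε(F) has 2|P| + |Q| vertices.
--
-- Both P and Q carry Hamiltonian paths of the TARS graph starting at V ∖ {x, y}. This holds for
-- every family "S ⊆ A dominating A ∖ W": remove from A a vertex without neighbours in A, or a leaf
-- of A together with its neighbour (acyclicity provides one of them), and traverse the sets sharing
-- a core as consecutive blocks, alternately forwards and backwards.
--
-- Along the path through P, the sets a ∪ {y} and a ∪ {x, y} form a ladder, and each a ∪ {x} with
-- a in Q is adjacent to both ends of the rung over a. Prefixes of the ladder have cycles of every
-- even length up to 2|P|, and a cycle may leave a prefix at the rung over the k-th set of the path
-- through Q and return along that path, which adds k vertices: every length from 3 to 2|P| + |Q|
-- occurs.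

module Submission where

open import Defs
open import Level using (0ℓ)
open import Relation.Binary using (Rel; Symmetric)

module Walks where

  open import Data.Bool using (Bool; true; false; not)
  open import Data.Empty using (⊥-elim)
  open import Data.Fin using (Fin; zero; suc; toℕ)
  open import Data.Fin.Properties using (toℕ-fromℕ<; toℕ≤pred[n]; toℕ-injective)
  open import Data.List as List using (List; []; _∷_; _++_; [_]; length)
  open import Data.List.Properties using (unfold-reverse; ++-identityʳ; length-++-sucʳ)
  open import Data.List.Membership.Propositional using (_∈_; _∉_)
  open import Data.List.Membership.Propositional.Properties
    using (∈-++⁺ˡ; ∈-++⁺ʳ; ∈-++⁻; ∈-∃++; ∈-lookup)
  open import Data.List.Relation.Unary.All as All using (All; []; _∷_)
  open import Data.List.Relation.Unary.Any using (here; there)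
  open import Data.List.Relation.Unary.Any.Properties using (reverse⁺; reverse⁻)
  open import Data.List.Relation.Unary.Unique.Propositional using (Unique; []; _∷_)
  import Data.List.Relation.Unary.Unique.Propositional.Properties as Unique
  open import Data.List.Relation.Binary.Permutation.Propositional using (↭⇒↭ₛ; ↭-sym)
  open import Data.List.Relation.Binary.Permutation.Propositional.Properties using (↭-reverse)
  import Data.List.Relation.Binary.Permutation.Setoid.Properties as Permutation
  open import Data.Nat using (ℕ; zero; suc; _+_; _≤_; _<_; _%_; _≤?_; z≤n; s≤s)
  open import Data.Nat.DivMod using (m≤n⇒m%n≡m; n%n≡0)
  open import Data.Nat.Properties
    using (suc-injective; m≤n⇒m<n∨m≡n; +-suc; +-comm; +-cancelˡ-≤; ≰⇒>; <⇒≱; +-mono-<;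
           m≤n⇒∃[o]m+o≡n; ≤-trans; n≤1+n)
  open import Data.Product using (∃; ∃₂; _×_; _,_)
  open import Data.Sum using (inj₁; inj₂)
  open import Function using (_∘_)
  open import Relation.Binary.PropositionalEquality
    using (_≡_; _≢_; refl; sym; trans; cong; cong₂; subst; subst₂; setoid)
  open import Relation.Nullary using (¬_; yes; no; contradiction)
  open import Relation.Unary using (Pred)

  private variable
    A B : Set
    a b c d e : A
    xs ys : List A

  -- A walk with vertex list a ∷ xs; its last vertex is b.
  data Path {A : Set} (R : Rel A 0ℓ) : A → List A → A → Set where
    []  : ∀ {a} → Path R a [] a
    _∷_ : ∀ {a b xs c} → R a b → Path R b xs c → Path R a (b ∷ xs) c

  module _ {R : Rel A 0ℓ} where

    infixr 5 _++⟨_⟩_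

    _++⟨_⟩_ : Path R a xs b → R b c → Path R c ys d → Path R a (xs ++ c ∷ ys) d
    []      ++⟨ r ⟩ q = r ∷ q
    (s ∷ p) ++⟨ r ⟩ q = s ∷ (p ++⟨ r ⟩ q)

    reverse : Symmetric R → Path R a xs b → ∃ λ ys → b ∷ ys ≡ List.reverse (a ∷ xs) × Path R b ys a
    reverse R-sym []                         = [] , refl , []
    reverse R-sym (_∷_ {a = a} {b} {xs} r p) with ys , eq , q ← reverse R-sym p =
      ys ++ [ a ] , trans (cong (_++ [ a ]) eq) (sym (unfold-reverse a (b ∷ xs))) , q ++⟨ R-sym r ⟩ []

    take : ∀ j → Path R a xs b → ∃ λ e → Path R a (List.take j xs) e
    take zero    p       = _ , []
    take (suc j) []      = _ , []
    take (suc j) (r ∷ p) with e , q ← take j p = e , r ∷ q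

    last-∈ : Path R a xs b → b ∈ a ∷ xs
    last-∈ []      = here refl
    last-∈ (r ∷ p) = there (last-∈ p)

  map : {R : Rel A 0ℓ} {S : Rel B 0ℓ} (f : A → B) → (∀ {u v} → R u v → S (f u) (f v)) →
        Path R a xs b → Path S (f a) (List.map f xs) (f b)
  map f f-hom []      = []
  map f f-hom (r ∷ p) = f-hom r ∷ map f f-hom p

  ∈-take⁻ : ∀ j {xs : List A} {w} → w ∈ List.take j xs → w ∈ xs
  ∈-take⁻ (suc j) {x ∷ xs} (here eq) = here eq
  ∈-take⁻ (suc j) {x ∷ xs} (there m) = there (∈-take⁻ j m)

  Unique-reverse : Unique xs → Unique (List.reverse xs)
  Unique-reverse {xs = xs} = Permutation.Unique-resp-↭ (setoid _) (↭⇒↭ₛ (↭-sym (↭-reverse xs)))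

  Unique∧⊆⇒length≤ : Unique xs → (∀ {v} → v ∈ xs → v ∈ ys) → length xs ≤ length ys
  Unique∧⊆⇒length≤ []                       xs⊆ys = z≤n
  Unique∧⊆⇒length≤ {xs = x ∷ xs} (x≢xs ∷ u) xs⊆ys
    with ys₁ , ys₂ , refl ← ∈-∃++ (xs⊆ys (here refl)) =
    subst (suc (length xs) ≤_) (sym (length-++-sucʳ ys₁ x ys₂))
      (s≤s (Unique∧⊆⇒length≤ u λ v∈xs → drop-x (xs⊆ys (there v∈xs)) (All.lookup x≢xs v∈xs)))
    where
    drop-x : ∀ {v} → v ∈ ys₁ ++ x ∷ ys₂ → x ≢ v → v ∈ ys₁ ++ ys₂
    drop-x m x≢v with ∈-++⁻ ys₁ m
    ... | inj₁ m₁         = ∈-++⁺ˡ m₁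
    ... | inj₂ (here eq)  = ⊥-elim (x≢v (sym eq))
    ... | inj₂ (there m₂) = ∈-++⁺ʳ ys₁ m₂

  toℕ-next : ∀ {k} (i : Fin (suc k)) → toℕ i < k → toℕ (next i) ≡ suc (toℕ i)
  toℕ-next i i<k = trans (toℕ-fromℕ< _) (m≤n⇒m%n≡m i<k)

  next-last : ∀ {k} (i : Fin (suc k)) → toℕ i ≡ k → next i ≡ zero
  next-last {k} i i≡k =
    toℕ-injective (trans (toℕ-fromℕ< _) (trans (cong (λ t → suc t % suc k) i≡k) (n%n≡0 (suc k))))

  lookup-injective : Unique xs → ∀ i j → List.lookup xs i ≡ List.lookup xs j → i ≡ j
  lookup-injective (x≢xs ∷ u) zero    zero    eq = refl
  lookup-injective (x≢xs ∷ u) zero    (suc j) eq = ⊥-elim (All.lookup x≢xs (∈-lookup j) eq)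
  lookup-injective (x≢xs ∷ u) (suc i) zero    eq = ⊥-elim (All.lookup x≢xs (∈-lookup i) (sym eq))
  lookup-injective (x≢xs ∷ u) (suc i) (suc j) eq = cong suc (lookup-injective u i j eq)

  module _ {R : Rel A 0ℓ} where

    lookup-step : Path R a xs b → ∀ (i j : Fin (length (a ∷ xs))) → toℕ j ≡ suc (toℕ i) →
                  R (List.lookup (a ∷ xs) i) (List.lookup (a ∷ xs) j)
    lookup-step (r ∷ p) zero    (suc zero)    _  = r
    lookup-step (r ∷ p) (suc i) (suc j)       eq = lookup-step p i j (suc-injective eq)
    lookup-step []      zero    zero          ()
    lookup-step (r ∷ p) zero    (suc (suc j)) ()
    lookup-step (r ∷ p) (suc i) zero          ()

    lookup-last : Path R a xs b → ∀ i → toℕ i ≡ length xs → List.lookup (a ∷ xs) i ≡ b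
    lookup-last []      zero    _  = refl
    lookup-last (r ∷ p) (suc i) eq = lookup-last p i (suc-injective eq)

    closedPath⇒Cycle : {P : Pred A 0ℓ} → Path R a xs b → R b a → Unique (a ∷ xs) → All P (a ∷ xs) →
                       Cycle P R (length (a ∷ xs))
    closedPath⇒Cycle {a = a} {xs} p r u ps = record
      { vert = List.lookup (a ∷ xs)
      ; inP  = λ i → All.lookup ps (∈-lookup i)
      ; inj  = lookup-injective u _ _
      ; step = step
      }
      where
      step : ∀ i → R (List.lookup (a ∷ xs) i) (List.lookup (a ∷ xs) (next i))
      step i with m≤n⇒m<n∨m≡n (toℕ≤pred[n] i)
      ... | inj₁ i<len = lookup-step p i (next i) (toℕ-next i i<len)
      ... | inj₂ i≡len =
        subst₂ R (sym (lookup-last p i i≡len)) (cong (List.lookup (a ∷ xs)) (sym (next-last i i≡len))) r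

    closedWalk⇒Cycle : {P : Pred A 0ℓ} (f : ℕ → A) {k : ℕ} →
                       (∀ i → P (f i)) → (∀ i → R (f i) (f (suc i))) → f (suc k) ≡ f 0 →
                       (∀ (i j : Fin (suc k)) → f (toℕ i) ≡ f (toℕ j) → i ≡ j) → Cycle P R (suc k)
    closedWalk⇒Cycle f {k} f∈P f-step closed f-inj = record
      { vert = f ∘ toℕ
      ; inP  = f∈P ∘ toℕ
      ; inj  = f-inj _ _
      ; step = step
      }
      where
      step : ∀ i → R (f (toℕ i)) (f (toℕ (next i)))
      step i with m≤n⇒m<n∨m≡n (toℕ≤pred[n] {suc k} i)
      ... | inj₁ i<k = subst (R (f (toℕ i)) ∘ f) (sym (toℕ-next i i<k)) (f-step (toℕ i))
      ... | inj₂ i≡k = subst (R (f (toℕ i)))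
        (trans (cong (f ∘ suc) i≡k) (trans closed (cong (f ∘ toℕ) (sym (next-last i i≡k))))) (f-step (toℕ i))

  mapCycle : {P : Pred A 0ℓ} {Q : Pred B 0ℓ} {R : Rel A 0ℓ} {S : Rel B 0ℓ} (f : A → B) →
             (∀ {u v} → P u → P v → f u ≡ f v → u ≡ v) → (∀ {u} → P u → Q (f u)) →
             (∀ {u v} → P u → P v → R u v → S (f u) (f v)) → ∀ {ℓ} → Cycle P R ℓ → Cycle Q S ℓ
  mapCycle f f-inj f-pres f-hom C = record
    { vert = f ∘ vert
    ; inP  = f-pres ∘ inP
    ; inj  = λ eq → inj (f-inj (inP _) (inP _) eq)
    ; step = λ i → f-hom (inP i) (inP (next i)) (step i)
    }
    where open Cycle C

  weakenCycle : {P Q : Pred A 0ℓ} {R : Rel A 0ℓ} → (∀ {u} → P u → Q u) →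
                ∀ {ℓ} → Cycle P R ℓ → Cycle Q R ℓ
  weakenCycle P⊆Q = mapCycle (λ u → u) (λ _ _ eq → eq) P⊆Q (λ _ _ r → r)

  data Parity : ℕ → Set where
    even : ∀ j → Parity (j + j)
    odd  : ∀ j → Parity (suc (j + j))

  parity : ∀ n → Parity n
  parity zero    = even 0
  parity (suc n) with parity n
  ... | even j = odd j
  ... | odd j  = subst Parity (cong suc (+-suc j j)) (even (suc j))

  double-cancel-≤ : ∀ {j m} → j + j ≤ m + m → j ≤ m
  double-cancel-≤ {j} {m} j+j≤m+m with j ≤? m
  ... | yes j≤m = j≤m
  ... | no  j≰m = contradiction j+j≤m+m (<⇒≱ (+-mono-< (≰⇒> j≰m) (≰⇒> j≰m)))

  data LadderLength (m m′ : ℕ) : ℕ → Set where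
    even : ∀ {i} → i < m  → LadderLength m m′ (suc i + suc i)
    odd  : ∀ {i} → i < m  → LadderLength m m′ (suc i + suc i + 1)
    long : ∀ {i} → i < m′ → LadderLength m m′ (m + m + suc i)

  ladderLength : ∀ {m m′ ℓ} → 3 ≤ ℓ → ℓ ≤ m + m + m′ → LadderLength m m′ ℓ
  ladderLength {m} {m′} {ℓ} 3≤ℓ ℓ≤ with ℓ ≤? m + m
  ... | no ℓ≰2m with k , refl ← m≤n⇒∃[o]m+o≡n (≰⇒> ℓ≰2m) =
    subst (LadderLength m m′) (+-suc (m + m) k)
      (long (+-cancelˡ-≤ (m + m) (suc k) m′ (subst (_≤ m + m + m′) (sym (+-suc (m + m) k)) ℓ≤)))
  ... | yes ℓ≤2m with parity ℓ
  ...   | even (suc i) = even (double-cancel-≤ ℓ≤2m)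
  ...   | odd (suc i)  =
    subst (LadderLength m m′) (+-comm (suc i + suc i) 1) (odd (double-cancel-≤ (≤-trans (n≤1+n _) ℓ≤2m)))
  ladderLength ()       _ | yes _ | even zero
  ladderLength (s≤s ()) _ | yes _ | odd zero

  record HamiltonianPath {A : Set} (R : Rel A 0ℓ) (P : Pred A 0ℓ) (start : A) : Set where
    field
      rest     : List A
      end      : A
      path     : Path R start rest end
      unique   : Unique (start ∷ rest)
      sound    : All P (start ∷ rest)
      complete : ∀ {v} → P v → v ∈ start ∷ rest

  -- Q is partitioned into blocks first a ∷ inner a, one for each a in P. Following a Hamiltonian
  -- path of P, the blocks are traversed alternately forwards and backwards, so that consecutive
  -- blocks meet at their first or at their last elements.
  module Snake {X Y : Set} {RX : Rel X 0ℓ} {R : Rel Y 0ℓ} (R-sym : Symmetric R)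
    {P : Pred X 0ℓ} {Q : Pred Y 0ℓ}
    (first last : X → Y) (inner : X → List Y) (core : Y → X)
    (block-path     : ∀ {a} → P a → Path R (first a) (inner a) (last a))
    (first-lift     : ∀ {a a′} → P a → P a′ → RX a a′ → R (first a) (first a′))
    (last-lift      : ∀ {a a′} → P a → P a′ → RX a a′ → R (last a) (last a′))
    (block-unique   : ∀ {a} → P a → Unique (first a ∷ inner a))
    (block-sound    : ∀ {a} → P a → All Q (first a ∷ inner a))
    (block-core     : ∀ {a w} → P a → w ∈ first a ∷ inner a → core w ≡ a)
    (block-complete : ∀ {w} → Q w → P (core w) × w ∈ first (core w) ∷ inner (core w))
    where

    block : X → List Y
    block a = first a ∷ inner a

    oriented : Bool → X → List Y
    oriented true  a = block a
    oriented false a = List.reverse (block a)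

    entry exit : Bool → X → Y
    entry true  = first
    entry false = last
    exit true   = last
    exit false  = first

    oriented-path : ∀ f {a} → P a →
                    ∃ λ ys → oriented f a ≡ entry f a ∷ ys × Path R (entry f a) ys (exit f a)
    oriented-path true  pa = _ , refl , block-path pa
    oriented-path false pa with ys , eq , q ← reverse R-sym (block-path pa) = ys , sym eq , q

    turn : ∀ f {a a′} → P a → P a′ → RX a a′ → R (exit f a) (entry (not f) a′)
    turn true  = last-lift
    turn false = first-lift

    ∈-oriented⁻ : ∀ f {a w} → w ∈ oriented f a → w ∈ block a
    ∈-oriented⁻ true  m = m
    ∈-oriented⁻ false m = reverse⁻ m

    ∈-oriented⁺ : ∀ f {a w} → w ∈ block a → w ∈ oriented f a
    ∈-oriented⁺ true  m = m
    ∈-oriented⁺ false m = reverse⁺ m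

    snake : Bool → List X → List Y
    snake f []       = []
    snake f (a ∷ as) = oriented f a ++ snake (not f) as

    snake-path : ∀ f {a as e} → Path RX a as e → All P (a ∷ as) →
                 ∃₂ λ ys e′ → snake f (a ∷ as) ≡ entry f a ∷ ys × Path R (entry f a) ys e′
    snake-path f [] (pa ∷ []) with ys , eq , q ← oriented-path f pa = ys , _ , trans (++-identityʳ _) eq , q
    snake-path f (r ∷ p) (pa ∷ ps@(pa′ ∷ _))
      with ys , eq , q ← oriented-path f pa | ys′ , e′ , eq′ , q′ ← snake-path (not f) p ps =
      _ , e′ , cong₂ _++_ eq eq′ , q ++⟨ turn f pa pa′ r ⟩ q′

    ∈-snake⁻ : ∀ f as {w} → w ∈ snake f as → ∃ λ a → a ∈ as × w ∈ block a
    ∈-snake⁻ f (a ∷ as) m with ∈-++⁻ (oriented f a) m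
    ... | inj₁ m₁ = a , here refl , ∈-oriented⁻ f m₁
    ... | inj₂ m₂ with a′ , a′∈as , m′ ← ∈-snake⁻ (not f) as m₂ = a′ , there a′∈as , m′

    ∈-snake⁺ : ∀ f {as a w} → a ∈ as → w ∈ block a → w ∈ snake f as
    ∈-snake⁺ f           (here refl)  m = ∈-++⁺ˡ (∈-oriented⁺ f m)
    ∈-snake⁺ f {a′ ∷ _} (there a∈as) m = ∈-++⁺ʳ (oriented f a′) (∈-snake⁺ (not f) a∈as m)

    snake-sound : ∀ f {as} → All P as → All Q (snake f as)
    snake-sound f ps = All.tabulate λ m →
      let a , a∈as , w∈block = ∈-snake⁻ f _ m in All.lookup (block-sound (All.lookup ps a∈as)) w∈block

    snake-unique : ∀ f {as} → All P as → Unique as → Unique (snake f as)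
    snake-unique f          []        []         = []
    snake-unique f {a ∷ as} (pa ∷ ps) (a∉as ∷ u) =
      Unique.++⁺ (oriented-unique f) (snake-unique (not f) ps u) disjoint
      where
      oriented-unique : ∀ f → Unique (oriented f a)
      oriented-unique true  = block-unique pa
      oriented-unique false = Unique-reverse (block-unique pa)
      disjoint : ∀ {w} → ¬ (w ∈ oriented f a × w ∈ snake (not f) as)
      disjoint (m₁ , m₂) with a′ , a′∈as , m′ ← ∈-snake⁻ (not f) as m₂ =
        All.lookup a∉as a′∈as
          (trans (sym (block-core pa (∈-oriented⁻ f m₁))) (block-core (All.lookup ps a′∈as) m′))

    hamiltonianPath : ∀ {a₀} → HamiltonianPath RX P a₀ → HamiltonianPath R Q (first a₀)
    hamiltonianPath H
      with ys , e , eq , p ← snake-path true (HamiltonianPath.path H) (HamiltonianPath.sound H) = record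
      { rest     = ys
      ; end      = e
      ; path     = p
      ; unique   = subst Unique eq (snake-unique true sound unique)
      ; sound    = subst (All Q) eq (snake-sound true sound)
      ; complete = complete′
      }
      where
      open HamiltonianPath H
      complete′ : ∀ {w} → Q w → w ∈ first _ ∷ ys
      complete′ {w} qw with pc , w∈block ← block-complete qw =
        subst (w ∈_) eq (∈-snake⁺ true (complete pc) w∈block)

module Ladder {X : Set} (RX : Rel X 0ℓ) (RX-sym : Symmetric RX) where

  open Walks

  open import Data.Bool using (Bool; true; false; not)
  open import Data.Bool.Properties using (not-involutive)
  open import Data.List as List using (List; []; _∷_; _++_; length)
  open import Data.List.Properties using (length-++; length-map; length-reverse; length-take)
  open import Data.List.Membership.Propositional using (_∈_; _∉_)
  open import Data.List.Membership.Propositional.Properties using (∈-map⁻)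
  open import Data.List.Relation.Unary.All as All using (All; []; _∷_)
  open import Data.List.Relation.Unary.All.Properties using (¬Any⇒All¬; All¬⇒¬Any; ++⁺)
  open import Data.List.Relation.Unary.Any using (here; there)
  open import Data.List.Relation.Unary.Any.Properties using (reverse⁻)
  open import Data.List.Relation.Unary.Unique.Propositional using (Unique; []; _∷_)
  import Data.List.Relation.Unary.Unique.Propositional.Properties as Unique
  open import Data.Nat using (suc; _+_; _≤_; _<_; s≤s)
  open import Data.Nat.Properties using (+-suc; m≤n⇒m⊓n≡m)
  open import Data.Product using (∃; _×_; _,_)
  open import Relation.Binary.PropositionalEquality using (_≡_; _≢_; refl; sym; trans; cong; cong₂; subst)
  open import Relation.Nullary using (¬_)
  open import Function using (_∘_)
  open import Relation.Unary using (Pred)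

  data Vertex : Set where
    row  : Bool → X → Vertex
    apex : X → Vertex

  base : Vertex → X
  base (row _ a) = a
  base (apex a)  = a

  data Edge : Rel Vertex 0ℓ where
    along      : ∀ {s a a′} → RX a a′ → Edge (row s a) (row s a′)
    along-apex : ∀ {a a′} → RX a a′ → Edge (apex a) (apex a′)
    rung       : ∀ {s a} → Edge (row s a) (row (not s) a)
    up         : ∀ {s a} → Edge (row s a) (apex a)
    down       : ∀ {s a} → Edge (apex a) (row s a)

  Edge-sym : Symmetric Edge
  Edge-sym (along r)      = along (RX-sym r)
  Edge-sym (along-apex r) = along-apex (RX-sym r)
  Edge-sym (rung {s})     = subst (λ t → Edge (row (not s) _) (row t _)) (not-involutive s) rung
  Edge-sym up             = down
  Edge-sym down           = up

  InLadder : List X → List X → Pred Vertex 0ℓ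
  InLadder L Z (row _ a) = a ∈ L
  InLadder L Z (apex a)  = a ∈ Z

  InLadder-mono : ∀ {L L′ Z Z′} → (∀ {z} → z ∈ L → z ∈ L′) → (∀ {z} → z ∈ Z → z ∈ Z′) →
                  ∀ {v} → InLadder L Z v → InLadder L′ Z′ v
  InLadder-mono L⊆L′ Z⊆Z′ {row _ _} = L⊆L′
  InLadder-mono L⊆L′ Z⊆Z′ {apex _}  = Z⊆Z′

  OnRows : List X → Pred Vertex 0ℓ
  OnRows L = InLadder L []

  private variable
    a c e : X
    as zs : List X

  row-injective : ∀ {s a a′} → row s a ≡ row s a′ → a ≡ a′
  row-injective refl = refl

  apex-injective : ∀ {a a′} → apex a ≡ apex a′ → a ≡ a′
  apex-injective refl = refl

  row≢row-not : ∀ s {a a′} → row s a ≢ row (not s) a′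
  row≢row-not true  ()
  row≢row-not false ()

  ∈-map-row⁻ : ∀ {s v L} → v ∈ List.map (row s) L → OnRows L v
  ∈-map-row⁻ m with _ , a∈L , refl ← ∈-map⁻ (row _) m = a∈L

  ∉-onRows : ∀ {L vs} → a ∉ L → All (OnRows L) vs → ∀ {t} → row t a ∉ vs
  ∉-onRows a∉L onRows m = a∉L (All.lookup onRows m)

  record Traversal (L : List X) (u v : Vertex) : Set where
    field
      inner   : List Vertex
      path    : Path Edge u inner v
      unique  : Unique (u ∷ inner)
      onRows  : All (OnRows L) (u ∷ inner)
      length≡ : length (u ∷ inner) ≡ length L + length L

  uTurn : ∀ s → Path RX a as e → Unique (a ∷ as) → Traversal (a ∷ as) (row s a) (row (not s) a)
  uTurn {a} {as} s p u with back , back≡ , q ← reverse Edge-sym (map (row (not s)) along p) = record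
    { inner   = List.map (row s) as ++ row (not s) _ ∷ back
    ; path    = map (row s) along p ++⟨ rung ⟩ q
    ; unique  = subst Unique (sym vertices≡)
        (Unique.++⁺ (Unique.map⁺ row-injective u) (Unique-reverse (Unique.map⁺ row-injective u)) disjoint)
    ; onRows  = subst (All _) (sym vertices≡)
        (++⁺ (All.tabulate ∈-map-row⁻) (All.tabulate (∈-map-row⁻ ∘ reverse⁻ {xs = returning})))
    ; length≡ = trans (cong length vertices≡) (trans (length-++ going)
        (cong₂ _+_ (length-map (row s) (a ∷ as)) (trans (length-reverse returning) (length-map _ (a ∷ as)))))
    }
    where
    going returning : List Vertex
    going     = List.map (row s) (a ∷ as)
    returning = List.map (row (not s)) (a ∷ as)
    vertices≡ : row s a ∷ List.map (row s) as ++ row (not s) _ ∷ back ≡ going ++ List.reverse returning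
    vertices≡ = cong (going ++_) back≡
    disjoint : ∀ {v} → ¬ (v ∈ going × v ∈ List.reverse returning)
    disjoint (m₁ , m₂)
      with _ , _ , refl ← ∈-map⁻ (row s) m₁ | _ , _ , eq ← ∈-map⁻ _ (reverse⁻ {xs = returning} m₂) =
      row≢row-not s eq

  -- Cross every rung before c, then make a U-turn at c.
  zigzag : ∀ s → Path RX a as e → Unique (a ∷ as) → c ∈ a ∷ as →
           ∃ λ s′ → Traversal (a ∷ as) (row s a) (row s′ c)
  zigzag s p u (here refl) = not s , uTurn s p u
  zigzag {a} {as} s (r ∷ p) (a≢as ∷ u) (there c∈as) with s′ , T ← zigzag (not s) p u c∈as = s′ , record
    { inner   = row (not s) a ∷ row (not s) _ ∷ inner
    ; path    = rung ∷ along r ∷ path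
    ; unique  = ¬Any⇒All¬ _ (λ { (here eq) → row≢row-not s eq ; (there m) → a∉rest m })
              ∷ ¬Any⇒All¬ _ a∉rest ∷ unique
    ; onRows  = here refl ∷ here refl ∷ All.map (InLadder-mono there (λ ())) onRows
    ; length≡ = cong suc (trans (cong suc length≡) (sym (+-suc (length as) (length as))))
    }
    where
    open Traversal T
    a∉rest : ∀ {t} → row t a ∉ row (not s) _ ∷ inner
    a∉rest = ∉-onRows (All¬⇒¬Any a≢as) onRows

  evenCycle : Path RX a as e → Unique (a ∷ as) →
              Cycle (OnRows (a ∷ as)) Edge (length (a ∷ as) + length (a ∷ as))
  evenCycle p u = subst (Cycle _ Edge) length≡ (closedPath⇒Cycle path rung unique onRows)
    where open Traversal (uTurn true p u)

  -- Through the ladder to the rung at c, then back to a along the apexes.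
  apexCycle : Path RX a as e → Unique (a ∷ as) → Path RX a zs c → Unique (a ∷ zs) → c ∈ a ∷ as →
              Cycle (InLadder (a ∷ as) (a ∷ zs)) Edge (length (a ∷ as) + length (a ∷ as) + length (a ∷ zs))
  apexCycle {a} {as} {zs = zs} {c} p u q uz c∈
    with _ , T ← zigzag true p u c∈ | back , back≡ , q′ ← reverse Edge-sym (map apex along-apex q) =
    subst (Cycle _ Edge) length≡′ (closedPath⇒Cycle (path ++⟨ up ⟩ q′) down unique′ inLadder)
    where
    open Traversal T
    apexes = List.map apex (a ∷ zs)
    ∈-back⁻ : ∀ {v} → v ∈ apex c ∷ back → ∃ λ z → z ∈ a ∷ zs × v ≡ apex z
    ∈-back⁻ m = ∈-map⁻ apex (reverse⁻ {xs = apexes} (subst (_ ∈_) back≡ m))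
    disjoint : ∀ {v} → ¬ (v ∈ row true a ∷ inner × v ∈ apex c ∷ back)
    disjoint (m₁ , m₂) with _ , _ , refl ← ∈-back⁻ m₂ with () ← All.lookup onRows m₁
    unique′ : Unique ((row true a ∷ inner) ++ apex c ∷ back)
    unique′ = Unique.++⁺ unique (subst Unique (sym back≡) (Unique-reverse (Unique.map⁺ apex-injective uz))) disjoint
    inLadder : All (InLadder (a ∷ as) (a ∷ zs)) ((row true a ∷ inner) ++ apex c ∷ back)
    inLadder = ++⁺ (All.map (InLadder-mono (λ m → m) (λ ())) onRows)
      (All.tabulate λ m → let _ , z∈ , eq = ∈-back⁻ m in subst (InLadder _ _) (sym eq) z∈)
    length≡′ : length ((row true a ∷ inner) ++ apex c ∷ back) ≡
               length (a ∷ as) + length (a ∷ as) + length (a ∷ zs)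
    length≡′ = trans (length-++ (row true a ∷ inner))
      (cong₂ _+_ length≡ (trans (cong length back≡) (trans (length-reverse apexes) (length-map apex (a ∷ zs)))))

  prefix-length : ∀ {i} → i < length (a ∷ as) → length (a ∷ List.take i as) ≡ suc i
  prefix-length {as = as} {i} (s≤s i≤) = cong suc (trans (length-take i as) (m≤n⇒m⊓n≡m i≤))

  pancyclic : Path RX a as e → Unique (a ∷ as) → Path RX a zs c → Unique (a ∷ zs) →
              (∀ {z} → z ∈ a ∷ zs → z ∈ a ∷ as) →
              ∀ ℓ → 3 ≤ ℓ → ℓ ≤ length (a ∷ as) + length (a ∷ as) + length (a ∷ zs) →
              Cycle (InLadder (a ∷ as) (a ∷ zs)) Edge ℓ
  pancyclic {a} {as} {zs = zs} p u q uz zs⊆as ℓ 3≤ℓ ℓ≤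
    with ladderLength {length (a ∷ as)} {length (a ∷ zs)} 3≤ℓ ℓ≤
  ... | even {i} i<m with _ , p′ ← take i p =
    subst (Cycle _ Edge) (cong (λ j → j + j) (prefix-length {a = a} {as = as} i<m))
      (weakenCycle (InLadder-mono (∈-take⁻ (suc i)) (λ ())) (evenCycle p′ (Unique.take⁺ (suc i) u)))
  ... | odd {i} i<m with _ , p′ ← take i p =
    subst (Cycle _ Edge) (cong (λ j → j + j + 1) (prefix-length {a = a} {as = as} i<m))
      (weakenCycle (InLadder-mono (∈-take⁻ (suc i)) λ { (here eq) → here eq ; (there ()) })
        (apexCycle p′ (Unique.take⁺ (suc i) u) [] ([] ∷ []) (here refl)))
  ... | long {i} i<m′ with _ , q′ ← take i q =
    subst (Cycle _ Edge) (cong (length (a ∷ as) + length (a ∷ as) +_) (prefix-length {a = a} {as = zs} i<m′))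
      (weakenCycle (InLadder-mono (λ m → m) (∈-take⁻ (suc i)))
        (apexCycle p u q′ (Unique.take⁺ (suc i) uz) (zs⊆as (∈-take⁻ (suc i) {a ∷ zs} (last-∈ q′)))))


open Walks

open import Data.Bool using (Bool; true; false)
open import Data.Bool.Properties using (∨-identityʳ; ∨-zeroʳ)
open import Data.Empty using (⊥; ⊥-elim)
open import Data.Fin using (Fin; zero; suc; toℕ)
open import Data.Fin.Properties using (_≟_; _<?_; all?; any?; pigeonhole; toℕ≤pred[n]; toℕ-injective)
open import Data.Fin.Subset as Subset
  using (Subset; _∈_; _∉_; _⊆_; _⊂_; _∪_; _-_; ⁅_⁆; Nonempty; Empty; inside; outside)
open import Data.Fin.Subset.Induction using (⊂-wellFounded)
open import Data.Fin.Subset.Properties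
  using (_∈?_; _⊆?_; ∈⊤; ∉⊥; ⊆⊤; ⊆-min; ⊆-antisym; x∈p∪q⁻; p⊆p∪q; q⊆p∪q; nonempty?;
         Empty-unique; ∪-identityʳ; p─⊥≡p; x∈p⇒p-x⊂p)
open import Data.List as List using (List; []; _∷_; _++_; length)
open import Data.List.Properties using (length-++; length-map)
import Data.List.Membership.Propositional as List
open import Data.List.Membership.Propositional.Properties
  using (∈-map⁺; ∈-map⁻; ∈-++⁺ˡ; ∈-++⁺ʳ; ∈-filter⁻)
open import Data.List.Relation.Unary.All as All using (All; []; _∷_)
open import Data.List.Relation.Unary.Any using (here; there)
open import Data.List.Relation.Unary.Unique.Propositional using (Unique; []; _∷_)
import Data.List.Relation.Unary.Unique.Propositional.Properties as Unique
open import Data.Nat as ℕ using (ℕ; zero; suc; _+_; _≤_; z≤n; s≤s)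
open import Data.Nat.Induction using (<-wellFounded)
open import Data.Nat.Properties
  using (+-suc; +-comm; +-assoc; +-identityʳ; n<1+n; m≤n⇒∃[o]m+o≡n; m≤n+m; <-cmp; ≤-trans)
open import Data.Product using (∃; ∃₂; _×_; _,_; proj₁; proj₂)
open import Data.Sum using (_⊎_; inj₁; inj₂)
open import Data.Unit using (tt)
open import Data.Vec using (_∷_; lookup; tabulate; _[_]≔_)
open import Data.Vec.Properties
  using (∷-injectiveʳ; []≔-idempotent; []≔-commutes; []≔-updates; []≔-minimal; []≔-lookup;
         lookup∘update; lookup∘update′; []=⇒lookup; lookup⇒[]=; lookup∘tabulate)
open import Function using (_∘_)
open import Induction.WellFounded using (Acc; acc)
open import Relation.Binary.Definitions using (tri<; tri≈; tri>)
open import Relation.Binary.PropositionalEquality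
  using (_≡_; _≢_; refl; sym; trans; cong; cong₂; subst; module ≡-Reasoning)
open import Relation.Nullary using (¬_; Dec; yes; no; does; contradiction)
open import Relation.Nullary.Decidable using (dec-true; _×-dec_; _⊎-dec_; _→-dec_; ¬?)
open import Relation.Unary using (Pred; Decidable)

private variable
  m : ℕ
  b : Bool

-- Inserting and deleting a vertex are point updates of the characteristic vector; the set
-- identities needed below all follow from the algebra of _[_]≔_.
p∪⁅x⁆≡p[x]≔inside : ∀ (p : Subset m) x → p ∪ ⁅ x ⁆ ≡ p [ x ]≔ inside
p∪⁅x⁆≡p[x]≔inside (s ∷ p) zero    = cong₂ _∷_ (∨-zeroʳ s) (∪-identityʳ p)
p∪⁅x⁆≡p[x]≔inside (s ∷ p) (suc x) = cong₂ _∷_ (∨-identityʳ s) (p∪⁅x⁆≡p[x]≔inside p x)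

p-x≡p[x]≔outside : ∀ (p : Subset m) x → p - x ≡ p [ x ]≔ outside
p-x≡p[x]≔outside (s ∷ p) zero    = cong (outside ∷_) (p─⊥≡p p)
p-x≡p[x]≔outside (s ∷ p) (suc x) = cong (s ∷_) (p-x≡p[x]≔outside p x)

x∈p[x]≔inside : ∀ (p : Subset m) x → x ∈ p [ x ]≔ inside
x∈p[x]≔inside = []≔-updates

x∉p[x]≔outside : ∀ (p : Subset m) x → x ∉ p [ x ]≔ outside
x∉p[x]≔outside p x x∈ with () ← trans (sym ([]=⇒lookup x∈)) ([]=⇒lookup ([]≔-updates p x))

x∈p∧x≢y⇒x∈p[y]≔b : ∀ {p : Subset m} {x y} → x ∈ p → x ≢ y → x ∈ p [ y ]≔ b
x∈p∧x≢y⇒x∈p[y]≔b {p = p} {x} {y} x∈p x≢y = []≔-minimal p x y x≢y x∈p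

x∈p[y]≔b∧x≢y⇒x∈p : ∀ {p : Subset m} {x y} → x ∈ p [ y ]≔ b → x ≢ y → x ∈ p
x∈p[y]≔b∧x≢y⇒x∈p {b = b} {p = p} {x} x∈ x≢y =
  lookup⇒[]= x p (trans (sym (lookup∘update′ x≢y p b)) ([]=⇒lookup x∈))

x∉p∧x≢y⇒x∉p[y]≔b : ∀ {p : Subset m} {x y} → x ∉ p → x ≢ y → x ∉ p [ y ]≔ b
x∉p∧x≢y⇒x∉p[y]≔b x∉p x≢y x∈ = x∉p (x∈p[y]≔b∧x≢y⇒x∈p x∈ x≢y)

x∈p[y]≔outside⇒x∈p∧x≢y : ∀ {p : Subset m} {x y} → x ∈ p [ y ]≔ outside → x ∈ p × x ≢ y
x∈p[y]≔outside⇒x∈p∧x≢y {p = p} {x} x∈ = x∈p[y]≔b∧x≢y⇒x∈p x∈ x≢y , x≢y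
  where
  x≢y : x ≢ _
  x≢y refl = x∉p[x]≔outside p x x∈

x∈p⇒p[x]≔inside≡p : ∀ {p : Subset m} {x} → x ∈ p → p [ x ]≔ inside ≡ p
x∈p⇒p[x]≔inside≡p {p = p} {x} x∈p = trans (cong (p [ x ]≔_) (sym ([]=⇒lookup x∈p))) ([]≔-lookup p x)

x∉p⇒p[x]≔outside≡p : ∀ {p : Subset m} {x} → x ∉ p → p [ x ]≔ outside ≡ p
x∉p⇒p[x]≔outside≡p {p = p} {x} x∉p with lookup p x in eq
... | inside  = contradiction (lookup⇒[]= x p eq) x∉p
... | outside = trans (cong (p [ x ]≔_) (sym eq)) ([]≔-lookup p x)

x∉p[x]≔b⇒b≡outside : ∀ {p : Subset m} {x} → x ∉ p [ x ]≔ b → b ≡ outside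
x∉p[x]≔b⇒b≡outside {b = inside}  {p} {x} x∉ = contradiction (x∈p[x]≔inside p x) x∉
x∉p[x]≔b⇒b≡outside {b = outside} _          = refl

lookup≡outside⇒∉ : ∀ {p : Subset m} {x} → lookup p x ≡ outside → x ∉ p
lookup≡outside⇒∉ eq x∈p with () ← trans (sym ([]=⇒lookup x∈p)) eq

x∈p⇒p[x]≔outside⊂p : ∀ {p : Subset m} {x} → x ∈ p → p [ x ]≔ outside ⊂ p
x∈p⇒p[x]≔outside⊂p {p = p} {x} x∈p = subst (_⊂ p) (p-x≡p[x]≔outside p x) (x∈p⇒p-x⊂p x∈p)

subset : {P : Pred (Fin m) 0ℓ} → Decidable P → Subset m
subset P? = tabulate (does ∘ P?)

∈-subset⁺ : {P : Pred (Fin m) 0ℓ} (P? : Decidable P) → ∀ {x} → P x → x ∈ subset P?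
∈-subset⁺ P? {x} px = lookup⇒[]= x (subset P?) (trans (lookup∘tabulate (does ∘ P?) x) (dec-true (P? x) px))

∈-subset⁻ : {P : Pred (Fin m) 0ℓ} (P? : Decidable P) → ∀ {x} → x ∈ subset P? → P x
∈-subset⁻ P? {x} x∈ with P? x | trans (sym (lookup∘tabulate (does ∘ P?) x)) ([]=⇒lookup x∈)
... | yes px | _ = px

module _ (G : Graph) where
  open Graph G renaming (sym to Adj-sym)

  private variable
    S T : Subset n
    x y z : Fin n

  Adj⇒≢ : Adj x y → x ≢ y
  Adj⇒≢ xy refl = irrefl xy

  data TARSMove (S : Subset n) : Subset n → Set where
    add    : x ∉ S → TARSMove S (S [ x ]≔ inside)
    remove : x ∈ S → TARSMove S (S [ x ]≔ outside)
    slide  : x ∈ S → y ∉ S → Adj x y → TARSMove S (S [ y ]≔ inside [ x ]≔ outside)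

  slid≡ : ∀ (S : Subset n) x y → (S ∪ ⁅ y ⁆) - x ≡ S [ y ]≔ inside [ x ]≔ outside
  slid≡ S x y = trans (p-x≡p[x]≔outside _ x) (cong (_[ x ]≔ outside) (p∪⁅x⁆≡p[x]≔inside S y))

  TARSAdj⇒TARSMove : TARSAdj G S T → TARSMove S T
  TARSAdj⇒TARSMove {S} (inj₁ (x , x∉S , refl)) =
    subst (TARSMove S) (sym (p∪⁅x⁆≡p[x]≔inside S x)) (add x∉S)
  TARSAdj⇒TARSMove {S} (inj₂ (inj₁ (x , x∈S , refl))) =
    subst (TARSMove S) (sym (p-x≡p[x]≔outside S x)) (remove x∈S)
  TARSAdj⇒TARSMove {S} (inj₂ (inj₂ (x , y , x∈S , _ , y∉S , xy , refl))) =
    subst (TARSMove S) (sym (slid≡ S x y)) (slide x∈S y∉S xy)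

  TARSMove⇒TARSAdj : TARSMove S T → TARSAdj G S T
  TARSMove⇒TARSAdj {S} (add {x} x∉S)    = inj₁ (x , x∉S , sym (p∪⁅x⁆≡p[x]≔inside S x))
  TARSMove⇒TARSAdj {S} (remove {x} x∈S) = inj₂ (inj₁ (x , x∈S , sym (p-x≡p[x]≔outside S x)))
  TARSMove⇒TARSAdj {S} (slide {x} {y} x∈S y∉S xy) =
    inj₂ (inj₂ (x , y , x∈S , y∈ , y∉S , xy , sym (slid≡ S x y)))
    where
    y∈ : y ∈ S [ y ]≔ inside [ x ]≔ outside
    y∈ = x∈p∧x≢y⇒x∈p[y]≔b (x∈p[x]≔inside S y) (Adj⇒≢ (Adj-sym xy))

  TARSMove-sym : TARSMove S T → TARSMove T S
  TARSMove-sym {S} (add {x} x∉S) =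
    subst (TARSMove _) (trans ([]≔-idempotent S x) (x∉p⇒p[x]≔outside≡p x∉S)) (remove (x∈p[x]≔inside S x))
  TARSMove-sym {S} (remove {x} x∈S) =
    subst (TARSMove _) (trans ([]≔-idempotent S x) (x∈p⇒p[x]≔inside≡p x∈S)) (add (x∉p[x]≔outside S x))
  TARSMove-sym {S} (slide {x} {y} x∈S y∉S xy) =
    subst (TARSMove _) back (slide y∈T (x∉p[x]≔outside _ x) (Adj-sym xy))
    where
    open ≡-Reasoning
    y∈T : y ∈ S [ y ]≔ inside [ x ]≔ outside
    y∈T = x∈p∧x≢y⇒x∈p[y]≔b (x∈p[x]≔inside S y) (Adj⇒≢ (Adj-sym xy))
    back : S [ y ]≔ inside [ x ]≔ outside [ x ]≔ inside [ y ]≔ outside ≡ S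
    back = begin
      S [ y ]≔ inside [ x ]≔ outside [ x ]≔ inside [ y ]≔ outside
        ≡⟨ cong (_[ y ]≔ outside) ([]≔-idempotent (S [ y ]≔ inside) x) ⟩
      S [ y ]≔ inside [ x ]≔ inside [ y ]≔ outside
        ≡⟨ cong (_[ y ]≔ outside) ([]≔-commutes S y x (Adj⇒≢ (Adj-sym xy))) ⟩
      S [ x ]≔ inside [ y ]≔ inside [ y ]≔ outside
        ≡⟨ []≔-idempotent (S [ x ]≔ inside) y ⟩
      S [ x ]≔ inside [ y ]≔ outside
        ≡⟨ cong (_[ y ]≔ outside) (x∈p⇒p[x]≔inside≡p x∈S) ⟩
      S [ y ]≔ outside
        ≡⟨ x∉p⇒p[x]≔outside≡p y∉S ⟩
      S ∎

  TARSMove-update : z ∉ S → z ∉ T → TARSMove S T → TARSMove (S [ z ]≔ b) (T [ z ]≔ b)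
  TARSMove-update {z} {S} z∉S z∉T (add {x} x∉S) =
    subst (TARSMove _) ([]≔-commutes S z x z≢x) (add (x∉p∧x≢y⇒x∉p[y]≔b x∉S (z≢x ∘ sym)))
    where
    z≢x : z ≢ x
    z≢x refl = z∉T (x∈p[x]≔inside S z)
  TARSMove-update {z} {S} z∉S z∉T (remove {x} x∈S) =
    subst (TARSMove _) ([]≔-commutes S z x z≢x) (remove (x∈p∧x≢y⇒x∈p[y]≔b x∈S (z≢x ∘ sym)))
    where
    z≢x : z ≢ x
    z≢x refl = z∉S x∈S
  TARSMove-update {z} {S} {b = b} z∉S z∉T (slide {x} {y} x∈S y∉S xy) =
    subst (TARSMove _) commuted
      (slide (x∈p∧x≢y⇒x∈p[y]≔b x∈S (z≢x ∘ sym)) (x∉p∧x≢y⇒x∉p[y]≔b y∉S (z≢y ∘ sym)) xy)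
    where
    open ≡-Reasoning
    z≢x : z ≢ x
    z≢x refl = z∉S x∈S
    z≢y : z ≢ y
    z≢y refl = z∉T (x∈p∧x≢y⇒x∈p[y]≔b (x∈p[x]≔inside S z) (Adj⇒≢ (Adj-sym xy)))
    commuted : S [ z ]≔ b [ y ]≔ inside [ x ]≔ outside ≡ S [ y ]≔ inside [ x ]≔ outside [ z ]≔ b
    commuted = begin
      S [ z ]≔ b [ y ]≔ inside [ x ]≔ outside ≡⟨ cong (_[ x ]≔ outside) ([]≔-commutes S z y z≢y) ⟩
      S [ y ]≔ inside [ z ]≔ b [ x ]≔ outside ≡⟨ []≔-commutes (S [ y ]≔ inside) z x z≢x ⟩
      S [ y ]≔ inside [ x ]≔ outside [ z ]≔ b ∎

  TARSAdj-sym : Symmetric (TARSAdj G)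
  TARSAdj-sym = TARSMove⇒TARSAdj ∘ TARSMove-sym ∘ TARSAdj⇒TARSMove

  TARSAdj-update : z ∉ S → z ∉ T → TARSAdj G S T → TARSAdj G (S [ z ]≔ b) (T [ z ]≔ b)
  TARSAdj-update z∉S z∉T = TARSMove⇒TARSAdj ∘ TARSMove-update z∉S z∉T ∘ TARSAdj⇒TARSMove

module _ (G : Graph) where
  open Graph G renaming (sym to Adj-sym)

  AtMostOneNeighbour : Subset n → Fin n → Set
  AtMostOneNeighbour A x = ∀ {y z} → y ∈ A → z ∈ A → Adj x y → Adj x z → y ≡ z

  TwoNeighbours : Subset n → Fin n → Set
  TwoNeighbours A x = ∃₂ λ y z → y ∈ A × z ∈ A × Adj x y × Adj x z × y ≢ z

  twoNeighbours? : ∀ A x → Dec (TwoNeighbours A x)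
  twoNeighbours? A x = any? λ y → any? λ z →
    (y ∈? A) ×-dec (z ∈? A) ×-dec adj? x y ×-dec adj? x z ×-dec ¬? (y ≟ z)

  module NonBacktrackingWalk (A : Subset n) (branching : ∀ {x} → x ∈ A → TwoNeighbours A x)
                             {x₀ : Fin n} (x₀∈A : x₀ ∈ A) where

    onward : ∀ p {c} → c ∈ A → ∃ λ q → q ∈ A × Adj c q × q ≢ p
    onward p c∈A with y , z , y∈A , z∈A , cy , cz , y≢z ← branching c∈A | y ≟ p
    ... | yes refl = z , z∈A , cz , y≢z ∘ sym
    ... | no y≢p   = y , y∈A , cy , y≢p

    record Arc : Set where
      constructor arc
      field
        {source target} : Fin n
        target∈A : target ∈ A
        edge     : Adj source target

    advance : Arc → Arc
    advance (arc {source = p} c∈A _) = let _ , q∈A , cq , _ = onward p c∈A in arc q∈A cq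

    advance-turns : ∀ α → Arc.target (advance α) ≢ Arc.source α
    advance-turns (arc {source = p} c∈A _) = proj₂ (proj₂ (proj₂ (onward p c∈A)))

    arcs : ℕ → Arc
    arcs zero    with y , _ , y∈A , _ , x₀y , _ ← branching x₀∈A = arc y∈A x₀y
    arcs (suc i) = advance (arcs i)

    walk : ℕ → Fin n
    walk i = Arc.target (arcs i)

    walk-adj : ∀ i → Adj (walk i) (walk (suc i))
    walk-adj i = Arc.edge (arcs (suc i))

    walk-non-backtracking : ∀ i → walk (suc (suc i)) ≢ walk i
    walk-non-backtracking i = advance-turns (arcs (suc i))

    shorten : ∀ a {i j} → i ℕ.< j → walk (a + i) ≡ walk (a + j) →
              ∃ λ o → suc (i + o) ≡ j × walk (a + i) ≡ walk (a + i + suc o)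
    shorten a {i} i<j eq with o , i+o≡j ← m≤n⇒∃[o]m+o≡n i<j =
      o , i+o≡j , trans eq (cong walk (sym (trans (+-assoc a i (suc o)) (cong (a +_) (trans (+-suc i o) i+o≡j)))))

    Repeat : ℕ → ℕ → Set
    Repeat a k = ∃₂ λ (i j : Fin (suc k)) → toℕ i ℕ.< toℕ j × walk (a + toℕ i) ≡ walk (a + toℕ j)

    repeat? : ∀ a k → Dec (Repeat a k)
    repeat? a k = any? λ i → any? λ j → (i <? j) ×-dec (walk (a + toℕ i) ≟ walk (a + toℕ j))

    -- A shortest closed subwalk is a cycle, of length at least 3 since the walk neither stays put
    -- nor turns back.
    no-closed-walk : IsForest G → ∀ {k} → Acc ℕ._<_ k → ∀ a → walk a ≡ walk (a + suc k) → ⊥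
    no-closed-walk forest {zero} _ a closed =
      irrefl (subst (Adj (walk a)) (sym (trans closed (cong walk (+-comm a 1)))) (walk-adj a))
    no-closed-walk forest {suc zero} _ a closed =
      walk-non-backtracking a (sym (trans closed (cong walk (+-comm a 2))))
    no-closed-walk forest {k@(suc (suc _))} (acc shorter) a closed with repeat? a k
    ... | yes (i , j , i<j , eq) with o , i+o≡j , closed′ ← shorten a i<j eq =
      no-closed-walk forest (shorter o<k) (a + toℕ i) closed′
      where
      o<k : o ℕ.< k
      o<k = ≤-trans (s≤s (m≤n+m o (toℕ i))) (subst (ℕ._≤ k) (sym i+o≡j) (toℕ≤pred[n] j))
    ... | no no-repeat = forest (suc k) (s≤s (s≤s (s≤s z≤n)))
      (closedWalk⇒Cycle (λ t → walk (a + t)) (λ _ → tt) step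
        (trans (sym closed) (cong walk (sym (+-identityʳ a)))) injective)
      where
      step : ∀ t → Adj (walk (a + t)) (walk (a + suc t))
      step t = subst (Adj (walk (a + t)) ∘ walk) (sym (+-suc a t)) (walk-adj (a + t))
      injective : ∀ i j → walk (a + toℕ i) ≡ walk (a + toℕ j) → i ≡ j
      injective i j eq with <-cmp (toℕ i) (toℕ j)
      ... | tri< i<j _ _ = contradiction (i , j , i<j , eq) no-repeat
      ... | tri≈ _ i≡j _ = toℕ-injective i≡j
      ... | tri> _ _ j<i = contradiction (j , i , j<i , sym eq) no-repeat

    ¬forest : ¬ IsForest G
    ¬forest forest
      with i , j , i<j , eq ← pigeonhole (n<1+n n) (walk ∘ toℕ)
      with o , _ , closed ← shorten 0 i<j eq = no-closed-walk forest (<-wellFounded o) (toℕ i) closed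

  forest⇒atMostOneNeighbour : IsForest G → ∀ A → Nonempty A → ∃ λ x → x ∈ A × AtMostOneNeighbour A x
  forest⇒atMostOneNeighbour forest A (x₀ , x₀∈A) with any? (λ x → (x ∈? A) ×-dec ¬? (twoNeighbours? A x))
  ... | yes (x , x∈A , ¬two) = x , x∈A , atMostOne
    where
    atMostOne : AtMostOneNeighbour A x
    atMostOne {y} {z} y∈A z∈A xy xz with y ≟ z
    ... | yes y≡z = y≡z
    ... | no  y≢z = contradiction (y , z , y∈A , z∈A , xy , xz , y≢z) ¬two
  ... | no none = ⊥-elim (NonBacktrackingWalk.¬forest A branching x₀∈A forest)
    where
    branching : ∀ {x} → x ∈ A → TwoNeighbours A x
    branching {x} x∈A with twoNeighbours? A x
    ... | yes two = two
    ... | no ¬two = contradiction (x , x∈A , ¬two) none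

module _ (G : Graph) where
  open Graph G renaming (sym to Adj-sym)

  -- The vertices of W count as dominated from outside A.
  Dominates : Subset n → Subset n → Subset n → Set
  Dominates A W S = S ⊆ A × (∀ v → v ∈ A → v ∉ W → v ∉ S → ∃ λ u → u ∈ S × Adj u v)

  dominates? : ∀ A W S → Dec (Dominates A W S)
  dominates? A W S = (S ⊆? A) ×-dec all? λ v →
    (v ∈? A) →-dec ¬? (v ∈? W) →-dec ¬? (v ∈? S) →-dec any? λ u → (u ∈? S) ×-dec adj? u v

  dominating⇒dominates : ∀ {S} → Dominating G S → Dominates Subset.⊤ Subset.⊥ S
  dominating⇒dominates dom = (λ _ → ∈⊤) , λ v _ _ v∉S → dom v v∉S

  dominates⇒dominating : ∀ {S} → Dominates Subset.⊤ Subset.⊥ S → Dominating G S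
  dominates⇒dominating (_ , dom) v v∉S = dom v ∈⊤ ∉⊥ v∉S

  Dominates-mono : ∀ {A W W′ S} → W ⊆ W′ → Dominates A W S → Dominates A W′ S
  Dominates-mono W⊆W′ (S⊆A , dom) = S⊆A , λ v v∈A v∉W′ → dom v v∈A (v∉W′ ∘ W⊆W′)

  HamPath : Subset n → Subset n → Set
  HamPath A W = HamiltonianPath (TARSAdj G) (Dominates A W) A

  module Isolated {A W : Subset n} {x : Fin n} (x∈A : x ∈ A) (isolated : ∀ {y} → y ∈ A → ¬ Adj x y) where

    A′ : Subset n
    A′ = A [ x ]≔ outside

    attach : Bool → Subset n → Subset n
    attach b a = a [ x ]≔ b

    detach : Subset n → Subset n
    detach = attach outside

    x∉ : ∀ {a} → a ⊆ A′ → x ∉ a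
    x∉ a⊆A′ x∈a = x∉p[x]≔outside A x (a⊆A′ x∈a)

    detach-attach : ∀ b {a} → a ⊆ A′ → detach (attach b a) ≡ a
    detach-attach b {a} a⊆A′ = trans ([]≔-idempotent a x) (x∉p⇒p[x]≔outside≡p (x∉ a⊆A′))

    attach-detach : ∀ S → attach (lookup S x) (detach S) ≡ S
    attach-detach S = trans ([]≔-idempotent S x) ([]≔-lookup S x)

    attach-dominates : ∀ b {a} → Dominates A′ W a → (b ≡ outside → x ∈ W) → Dominates A W (attach b a)
    attach-dominates b {a} (a⊆A′ , dom) x∈W = attach⊆A , dominated
      where
      attach⊆A : attach b a ⊆ A
      attach⊆A {v} v∈ with v ≟ x
      ... | yes refl = x∈A
      ... | no v≢x   = proj₁ (x∈p[y]≔outside⇒x∈p∧x≢y (a⊆A′ (x∈p[y]≔b∧x≢y⇒x∈p v∈ v≢x)))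
      dominated : ∀ v → v ∈ A → v ∉ W → v ∉ attach b a → ∃ λ u → u ∈ attach b a × Adj u v
      dominated v v∈A v∉W v∉ with v ≟ x
      ... | yes refl = contradiction (x∈W (x∉p[x]≔b⇒b≡outside v∉)) v∉W
      ... | no v≢x
        with u , u∈a , uv ← dom v (x∈p∧x≢y⇒x∈p[y]≔b v∈A v≢x) v∉W
                                  (v∉ ∘ λ v∈a → x∈p∧x≢y⇒x∈p[y]≔b v∈a v≢x) =
        u , x∈p∧x≢y⇒x∈p[y]≔b u∈a (λ { refl → x∉ a⊆A′ u∈a }) , uv

    detach-dominates : ∀ {S} → Dominates A W S → Dominates A′ W (detach S)
    detach-dominates {S} (S⊆A , dom) = detach⊆A′ , dominated
      where
      detach⊆A′ : detach S ⊆ A′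
      detach⊆A′ v∈ = let v∈S , v≢x = x∈p[y]≔outside⇒x∈p∧x≢y v∈ in
                     x∈p∧x≢y⇒x∈p[y]≔b (S⊆A v∈S) v≢x
      dominated : ∀ v → v ∈ A′ → v ∉ W → v ∉ detach S → ∃ λ u → u ∈ detach S × Adj u v
      dominated v v∈A′ v∉W v∉ with v∈A , v≢x ← x∈p[y]≔outside⇒x∈p∧x≢y v∈A′
        with u , u∈S , uv ← dom v v∈A v∉W (v∉ ∘ λ v∈S → x∈p∧x≢y⇒x∈p[y]≔b v∈S v≢x) =
        u , x∈p∧x≢y⇒x∈p[y]≔b u∈S (λ { refl → isolated v∈A uv }) , uv

    x∉W⇒x∈S : ∀ {S} → x ∉ W → Dominates A W S → x ∈ S
    x∉W⇒x∈S {S} x∉W (S⊆A , dom) with x ∈? S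
    ... | yes x∈S = x∈S
    ... | no x∉S with u , u∈S , ux ← dom x x∈A x∉W x∉S = contradiction (Adj-sym ux) (isolated (S⊆A u∈S))

    inner : Subset n → List (Subset n)
    inner a with x ∈? W
    ... | yes _ = attach outside a ∷ []
    ... | no _  = []

    last : Subset n → Subset n
    last a with x ∈? W
    ... | yes _ = attach outside a
    ... | no _  = attach inside a

    block-path : ∀ {a} → Dominates A′ W a → Path (TARSAdj G) (attach inside a) (inner a) (last a)
    block-path {a} _ with x ∈? W
    ... | yes _ = subst (TARSAdj G _) ([]≔-idempotent a x) (TARSMove⇒TARSAdj G (remove (x∈p[x]≔inside a x))) ∷ []
    ... | no _  = []

    lift : ∀ b {a a′} → Dominates A′ W a → Dominates A′ W a′ → TARSAdj G a a′ →
           TARSAdj G (attach b a) (attach b a′)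
    lift b (a⊆A′ , _) (a′⊆A′ , _) = TARSAdj-update G (x∉ a⊆A′) (x∉ a′⊆A′)

    last-lift : ∀ {a a′} → Dominates A′ W a → Dominates A′ W a′ → TARSAdj G a a′ →
                TARSAdj G (last a) (last a′)
    last-lift with x ∈? W
    ... | yes _ = lift outside
    ... | no _  = lift inside

    ∈-block⁻ : ∀ {a S} → S List.∈ attach inside a ∷ inner a → ∃ λ b → S ≡ attach b a
    ∈-block⁻ (here eq) = inside , eq
    ∈-block⁻ {a} (there m) with x ∈? W | m
    ... | yes _ | here eq = outside , eq

    block-unique : ∀ {a} → Dominates A′ W a → Unique (attach inside a ∷ inner a)
    block-unique {a} _ with x ∈? W
    ... | yes _ = (distinct ∷ []) ∷ [] ∷ []
      where
      distinct : attach inside a ≢ attach outside a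
      distinct eq = x∉p[x]≔outside a x (subst (x ∈_) eq (x∈p[x]≔inside a x))
    ... | no _  = [] ∷ []

    block-sound : ∀ {a} → Dominates A′ W a → All (Dominates A W) (attach inside a ∷ inner a)
    block-sound dom with x ∈? W
    ... | yes x∈W = attach-dominates inside dom (λ ()) ∷ attach-dominates outside dom (λ _ → x∈W) ∷ []
    ... | no _    = attach-dominates inside dom (λ ()) ∷ []

    block-core : ∀ {a S} → Dominates A′ W a → S List.∈ attach inside a ∷ inner a → detach S ≡ a
    block-core (a⊆A′ , _) m with b , refl ← ∈-block⁻ m = detach-attach b a⊆A′

    block-complete : ∀ {S} → Dominates A W S →
                     Dominates A′ W (detach S) × S List.∈ attach inside (detach S) ∷ inner (detach S)
    block-complete {S} dom = detach-dominates dom , in-block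
      where
      in-block : S List.∈ attach inside (detach S) ∷ inner (detach S)
      in-block with x ∈? W | lookup S x in x-bit | attach-detach S
      ... | _      | inside  | S≡ = here (sym S≡)
      ... | yes _  | outside | S≡ = there (here (sym S≡))
      ... | no x∉W | outside | _  = contradiction (x∉W⇒x∈S x∉W dom) (lookup≡outside⇒∉ x-bit)

    extend : HamPath A′ W → HamPath A W
    extend H = subst (HamiltonianPath (TARSAdj G) (Dominates A W)) A′≡
      (Snake.hamiltonianPath (TARSAdj-sym G) (attach inside) last inner detach
        block-path (lift inside) last-lift block-unique block-sound block-core block-complete H)
      where
      A′≡ : attach inside A′ ≡ A
      A′≡ = trans ([]≔-idempotent A x) (x∈p⇒p[x]≔inside≡p x∈A)

  neighbourhood : Fin n → Subset n
  neighbourhood x = subset (adj? x)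

  module Leaf {A W : Subset n} {x y : Fin n} (x∈A : x ∈ A) (y∈A : y ∈ A) (xy : Adj x y)
              (pendant : ∀ {z} → z ∈ A → Adj x z → z ≡ y) where

    x≢y : x ≢ y
    x≢y = Adj⇒≢ G xy

    y≢x : y ≢ x
    y≢x = x≢y ∘ sym

    attach : Bool × Bool → Subset n → Subset n
    attach (bx , by) a = a [ x ]≔ bx [ y ]≔ by

    detach : Subset n → Subset n
    detach = attach (outside , outside)

    bits : Subset n → Bool × Bool
    bits S = lookup S x , lookup S y

    -- A set containing y dominates N(y) through y, so its core only has to dominate A″ outside W″.
    A″ W″ : Subset n
    A″ = detach A
    W″ = W ∪ neighbourhood y

    ∈-attach⁺ : ∀ {β a v} → v ∈ a → v ≢ x → v ≢ y → v ∈ attach β a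
    ∈-attach⁺ v∈a v≢x v≢y = x∈p∧x≢y⇒x∈p[y]≔b (x∈p∧x≢y⇒x∈p[y]≔b v∈a v≢x) v≢y

    ∈-attach⁻ : ∀ {β a v} → v ∈ attach β a → v ≢ x → v ≢ y → v ∈ a
    ∈-attach⁻ v∈ v≢x v≢y = x∈p[y]≔b∧x≢y⇒x∈p (x∈p[y]≔b∧x≢y⇒x∈p v∈ v≢y) v≢x

    x∈attach : ∀ {by} a → x ∈ attach (inside , by) a
    x∈attach a = x∈p∧x≢y⇒x∈p[y]≔b (x∈p[x]≔inside a x) x≢y

    y∈attach : ∀ {bx} a → y ∈ attach (bx , inside) a
    y∈attach a = x∈p[x]≔inside _ y

    x∉attach : ∀ {by} a → x ∉ attach (outside , by) a
    x∉attach a = x∉p∧x≢y⇒x∉p[y]≔b (x∉p[x]≔outside a x) x≢y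

    y∉attach : ∀ {bx} a → y ∉ attach (bx , outside) a
    y∉attach a = x∉p[x]≔outside _ y

    ∈-detach⁻ : ∀ {S v} → v ∈ detach S → v ∈ S × v ≢ x × v ≢ y
    ∈-detach⁻ {S} v∈ = ∈-attach⁻ v∈ v≢x v≢y , v≢x , v≢y
      where
      v≢x : _ ≢ x
      v≢x refl = x∉attach S v∈
      v≢y : _ ≢ y
      v≢y refl = y∉attach S v∈

    x∉ : ∀ {a} → a ⊆ A″ → x ∉ a
    x∉ a⊆A″ x∈a = proj₁ (proj₂ (∈-detach⁻ (a⊆A″ x∈a))) refl

    y∉ : ∀ {a} → a ⊆ A″ → y ∉ a
    y∉ a⊆A″ y∈a = proj₂ (proj₂ (∈-detach⁻ (a⊆A″ y∈a))) refl

    core⊆attach : ∀ {β a} → a ⊆ A″ → a ⊆ attach β a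
    core⊆attach a⊆A″ u∈a =
      ∈-attach⁺ u∈a (λ { refl → x∉ a⊆A″ u∈a }) (λ { refl → y∉ a⊆A″ u∈a })

    bits-attach : ∀ β a → bits (attach β a) ≡ β
    bits-attach (bx , by) a = cong₂ _,_
      (trans (lookup∘update′ x≢y (a [ x ]≔ bx) by) (lookup∘update x a bx)) (lookup∘update y (a [ x ]≔ bx) by)

    detach-attach : ∀ β {a} → a ⊆ A″ → detach (attach β a) ≡ a
    detach-attach (bx , by) {a} a⊆A″ = begin
      a [ x ]≔ bx [ y ]≔ by [ x ]≔ outside [ y ]≔ outside
        ≡⟨ cong (_[ y ]≔ outside) ([]≔-commutes (a [ x ]≔ bx) y x y≢x) ⟩
      a [ x ]≔ bx [ x ]≔ outside [ y ]≔ by [ y ]≔ outside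
        ≡⟨ []≔-idempotent _ y ⟩
      a [ x ]≔ bx [ x ]≔ outside [ y ]≔ outside
        ≡⟨ cong (_[ y ]≔ outside) ([]≔-idempotent a x) ⟩
      a [ x ]≔ outside [ y ]≔ outside
        ≡⟨ cong (_[ y ]≔ outside) (x∉p⇒p[x]≔outside≡p (x∉ a⊆A″)) ⟩
      a [ y ]≔ outside
        ≡⟨ x∉p⇒p[x]≔outside≡p (y∉ a⊆A″) ⟩
      a ∎
      where open ≡-Reasoning

    attach-injective : ∀ {β β′ a a′} → a ⊆ A″ → a′ ⊆ A″ → attach β a ≡ attach β′ a′ →
                       β ≡ β′ × a ≡ a′
    attach-injective {β} {β′} {a} {a′} a⊆A″ a′⊆A″ eq =
      trans (sym (bits-attach β a)) (trans (cong bits eq) (bits-attach β′ a′)) ,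
      trans (sym (detach-attach β a⊆A″)) (trans (cong detach eq) (detach-attach β′ a′⊆A″))

    attach-detach : ∀ S → attach (bits S) (detach S) ≡ S
    attach-detach S = begin
      S [ x ]≔ outside [ y ]≔ outside [ x ]≔ lookup S x [ y ]≔ lookup S y
        ≡⟨ cong (_[ y ]≔ lookup S y) ([]≔-commutes (S [ x ]≔ outside) y x y≢x) ⟩
      S [ x ]≔ outside [ x ]≔ lookup S x [ y ]≔ outside [ y ]≔ lookup S y
        ≡⟨ []≔-idempotent _ y ⟩
      S [ x ]≔ outside [ x ]≔ lookup S x [ y ]≔ lookup S y
        ≡⟨ cong (_[ y ]≔ lookup S y) (trans ([]≔-idempotent S x) ([]≔-lookup S x)) ⟩
      S [ y ]≔ lookup S y
        ≡⟨ []≔-lookup S y ⟩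
      S ∎
      where open ≡-Reasoning

    toggle-x : ∀ by a → TARSAdj G (attach (inside , by) a) (attach (outside , by) a)
    toggle-x by a = subst (TARSAdj G _) removed (TARSMove⇒TARSAdj G (remove (x∈attach a)))
      where
      removed : a [ x ]≔ inside [ y ]≔ by [ x ]≔ outside ≡ a [ x ]≔ outside [ y ]≔ by
      removed = trans ([]≔-commutes (a [ x ]≔ inside) y x y≢x) (cong (_[ y ]≔ by) ([]≔-idempotent a x))

    toggle-y : ∀ bx a → TARSAdj G (attach (bx , inside) a) (attach (bx , outside) a)
    toggle-y bx a = subst (TARSAdj G _) ([]≔-idempotent _ y) (TARSMove⇒TARSAdj G (remove (y∈attach a)))

    slide-x→y : ∀ a → TARSAdj G (attach (inside , outside) a) (attach (outside , inside) a)
    slide-x→y a = subst (TARSAdj G _) slid (TARSMove⇒TARSAdj G (slide (x∈attach a) (y∉attach a) xy))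
      where
      slid : a [ x ]≔ inside [ y ]≔ outside [ y ]≔ inside [ x ]≔ outside ≡ a [ x ]≔ outside [ y ]≔ inside
      slid = trans (cong (_[ x ]≔ outside) ([]≔-idempotent _ y))
             (trans ([]≔-commutes (a [ x ]≔ inside) y x y≢x) (cong (_[ y ]≔ inside) ([]≔-idempotent a x)))

    attach-lift : ∀ β {a a′} → a ⊆ A″ → a′ ⊆ A″ → TARSAdj G a a′ →
                  TARSAdj G (attach β a) (attach β a′)
    attach-lift β a⊆A″ a′⊆A″ =
      TARSAdj-update G (x∉p∧x≢y⇒x∉p[y]≔b (y∉ a⊆A″) y≢x)
                       (x∉p∧x≢y⇒x∉p[y]≔b (y∉ a′⊆A″) y≢x)
      ∘ TARSAdj-update G (x∉ a⊆A″) (x∉ a′⊆A″)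

    PairCovered : Subset n → Set
    PairCovered a = x ∈ W × (y ∈ W ⊎ ∃ λ u → u ∈ a × Adj u y)

    pairCovered? : ∀ a → Dec (PairCovered a)
    pairCovered? a = (x ∈? W) ×-dec ((y ∈? W) ⊎-dec any? λ u → (u ∈? a) ×-dec adj? u y)

    -- The bit patterns β for which attach β a dominates A outside W.
    Admissible : Bool × Bool → Subset n → Set
    Admissible (_       , inside)  a = Dominates A″ W″ a
    Admissible (inside  , outside) a = Dominates A″ W a
    Admissible (outside , outside) a = Dominates A″ W a × PairCovered a

    attach⊆A : ∀ β {a} → a ⊆ A″ → attach β a ⊆ A
    attach⊆A β a⊆A″ {v} v∈ with v ≟ x | v ≟ y
    ... | yes refl | _        = x∈A
    ... | no _     | yes refl = y∈A
    ... | no v≢x   | no v≢y   = proj₁ (∈-detach⁻ (a⊆A″ (∈-attach⁻ v∈ v≢x v≢y)))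

    dominated-off-pair : ∀ β {W′ a v} → Dominates A″ W′ a → v ∈ A → v ≢ x → v ≢ y → v ∉ W′ →
                         v ∉ attach β a → ∃ λ u → u ∈ attach β a × Adj u v
    dominated-off-pair β (a⊆A″ , dom) v∈A v≢x v≢y v∉W′ v∉
      with u , u∈a , uv ← dom _ (∈-attach⁺ v∈A v≢x v≢y) v∉W′
                                (λ v∈a → v∉ (∈-attach⁺ v∈a v≢x v≢y)) =
      u , core⊆attach a⊆A″ u∈a , uv

    attach-dominates : ∀ β {a} → Admissible β a → Dominates A W (attach β a)
    attach-dominates β@(bx , inside) {a} dom = attach⊆A β (proj₁ dom) , dominated
      where
      dominated : ∀ v → v ∈ A → v ∉ W → v ∉ attach β a → ∃ λ u → u ∈ attach β a × Adj u v
      dominated v v∈A v∉W v∉ with v ≟ y | v ≟ x | adj? y v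
      ... | yes refl | _        | _      = contradiction (y∈attach a) v∉
      ... | no _     | yes refl | _      = y , y∈attach a , Adj-sym xy
      ... | no _     | no _     | yes yv = y , y∈attach a , yv
      ... | no v≢y   | no v≢x   | no ¬yv = dominated-off-pair β dom v∈A v≢x v≢y v∉W″ v∉
        where
        v∉W″ : v ∉ W″
        v∉W″ v∈W″ with x∈p∪q⁻ W (neighbourhood y) v∈W″
        ... | inj₁ v∈W  = v∉W v∈W
        ... | inj₂ v∈Ny = ¬yv (∈-subset⁻ (adj? y) v∈Ny)
    attach-dominates β@(inside , outside) {a} dom = attach⊆A β (proj₁ dom) , dominated
      where
      dominated : ∀ v → v ∈ A → v ∉ W → v ∉ attach β a → ∃ λ u → u ∈ attach β a × Adj u v
      dominated v v∈A v∉W v∉ with v ≟ x | v ≟ y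
      ... | yes refl | _        = contradiction (x∈attach a) v∉
      ... | no _     | yes refl = x , x∈attach a , xy
      ... | no v≢x   | no v≢y   = dominated-off-pair β dom v∈A v≢x v≢y v∉W v∉
    attach-dominates β@(outside , outside) {a} (dom , x∈W , y-covered) =
      attach⊆A β (proj₁ dom) , dominated
      where
      y-dominated : y ∈ W ⊎ (∃ λ u → u ∈ a × Adj u y) → y ∉ W → ∃ λ u → u ∈ attach β a × Adj u y
      y-dominated (inj₁ y∈W)            y∉W = contradiction y∈W y∉W
      y-dominated (inj₂ (u , u∈a , uy)) _   =
        u , core⊆attach (proj₁ dom) u∈a , uy
      dominated : ∀ v → v ∈ A → v ∉ W → v ∉ attach β a → ∃ λ u → u ∈ attach β a × Adj u v
      dominated v v∈A v∉W v∉ with v ≟ x | v ≟ y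
      ... | yes refl | _        = contradiction x∈W v∉W
      ... | no _     | yes refl = y-dominated y-covered v∉W
      ... | no v≢x   | no v≢y   = dominated-off-pair β dom v∈A v≢x v≢y v∉W v∉

    detach-dominates : ∀ {W′ S} → Dominates A W S → W ⊆ W′ →
                       (y ∈ S → ∀ {v} → Adj y v → v ∈ W′) →
                       Dominates A″ W′ (detach S)
    detach-dominates {W′} {S} (S⊆A , dom) W⊆W′ y-absorbed = detach⊆A″ , dominated
      where
      detach⊆A″ : detach S ⊆ A″
      detach⊆A″ v∈ = let v∈S , v≢x , v≢y = ∈-detach⁻ v∈ in ∈-attach⁺ (S⊆A v∈S) v≢x v≢y
      dominated : ∀ v → v ∈ A″ → v ∉ W′ → v ∉ detach S → ∃ λ u → u ∈ detach S × Adj u v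
      dominated v v∈A″ v∉W′ v∉ with v∈A , v≢x , v≢y ← ∈-detach⁻ v∈A″
        with u , u∈S , uv ← dom v v∈A (v∉W′ ∘ W⊆W′) (λ v∈S → v∉ (∈-attach⁺ v∈S v≢x v≢y)) =
        u , ∈-attach⁺ u∈S (λ { refl → v≢y (pendant v∈A uv) })
                          (λ { refl → v∉W′ (y-absorbed u∈S uv) }) , uv

    detach-dominates″ : ∀ {S} → Dominates A W S → Dominates A″ W″ (detach S)
    detach-dominates″ dom = detach-dominates dom (p⊆p∪q _) λ _ yv → q⊆p∪q W _ (∈-subset⁺ (adj? y) yv)

    detach-dominates-without-y : ∀ {S} → Dominates A W S → y ∉ S → Dominates A″ W (detach S)
    detach-dominates-without-y dom y∉S = detach-dominates dom (λ v∈ → v∈) λ y∈S → contradiction y∈S y∉S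

    detach-covered : ∀ {S} → Dominates A W S → x ∉ S → y ∉ S → PairCovered (detach S)
    detach-covered {S} (S⊆A , dom) x∉S y∉S = x∈W , y-covered
      where
      x∈W : x ∈ W
      x∈W with x ∈? W
      ... | yes x∈W = x∈W
      ... | no x∉W with u , u∈S , ux ← dom x x∈A x∉W x∉S =
        contradiction (subst (_∈ S) (pendant (S⊆A u∈S) (Adj-sym ux)) u∈S) y∉S
      y-covered : y ∈ W ⊎ ∃ λ u → u ∈ detach S × Adj u y
      y-covered with y ∈? W
      ... | yes y∈W = inj₁ y∈W
      ... | no y∉W with u , u∈S , uy ← dom y y∈A y∉W y∉S =
        inj₂ (u , ∈-attach⁺ u∈S (λ { refl → x∉S u∈S }) (λ { refl → irrefl uy }) , uy)

    detach-admissible : ∀ {S} → Dominates A W S → Admissible (bits S) (detach S)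
    detach-admissible {S} dom with lookup S x in x-bit | lookup S y in y-bit
    ... | _       | inside  = detach-dominates″ dom
    ... | inside  | outside = detach-dominates-without-y dom (lookup≡outside⇒∉ y-bit)
    ... | outside | outside = detach-dominates-without-y dom (lookup≡outside⇒∉ y-bit) ,
                              detach-covered dom (lookup≡outside⇒∉ x-bit) (lookup≡outside⇒∉ y-bit)

    -- The sets with core a, listed so that consecutive ones are TARS-adjacent.
    trail : Subset n → List (Bool × Bool)
    trail a with dominates? A″ W a | pairCovered? a
    ... | yes _ | yes _ = (inside , outside) ∷ (outside , outside) ∷ (outside , inside) ∷ []
    ... | yes _ | no _  = (inside , outside) ∷ (outside , inside) ∷ []
    ... | no _  | _     = (outside , inside) ∷ []

    route : Subset n → List (Bool × Bool)
    route a = (inside , inside) ∷ trail a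

    route-unique : ∀ a → Unique (route a)
    route-unique a with dominates? A″ W a | pairCovered? a
    ... | yes _ | yes _ =
      ((λ ()) ∷ (λ ()) ∷ (λ ()) ∷ []) ∷ ((λ ()) ∷ (λ ()) ∷ []) ∷ ((λ ()) ∷ []) ∷ [] ∷ []
    ... | yes _ | no _  = ((λ ()) ∷ (λ ()) ∷ []) ∷ ((λ ()) ∷ []) ∷ [] ∷ []
    ... | no _  | _     = ((λ ()) ∷ []) ∷ [] ∷ []

    ∈-route⇒admissible : ∀ {a β} → Dominates A″ W″ a → β List.∈ route a → Admissible β a
    ∈-route⇒admissible dom″ (here refl) = dom″
    ∈-route⇒admissible {a} dom″ (there m) with dominates? A″ W a | pairCovered? a | m
    ... | yes dom | yes cov | here refl                 = dom
    ... | yes dom | yes cov | there (here refl)         = dom , cov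
    ... | yes _   | yes _   | there (there (here refl)) = dom″
    ... | yes dom | no _    | here refl                 = dom
    ... | yes _   | no _    | there (here refl)         = dom″
    ... | no _    | _       | here refl                 = dom″

    admissible⇒∈-route : ∀ {a} β → Admissible β a → β List.∈ route a
    admissible⇒∈-route {a} β adm with dominates? A″ W a | pairCovered? a | β | adm
    ... | _       | _       | inside  , inside  | _       = here refl
    ... | yes _   | yes _   | inside  , outside | _       = there (here refl)
    ... | yes _   | no _    | inside  , outside | _       = there (here refl)
    ... | no ¬dom | _       | inside  , outside | dom     = contradiction dom ¬dom
    ... | yes _   | yes _   | outside , outside | _       = there (there (here refl))
    ... | yes _   | no ¬cov | outside , outside | _ , cov = contradiction cov ¬cov
    ... | no ¬dom | _       | outside , outside | dom , _ = contradiction dom ¬dom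
    ... | yes _   | yes _   | outside , inside  | _       = there (there (there (here refl)))
    ... | yes _   | no _    | outside , inside  | _       = there (there (here refl))
    ... | no _    | _       | outside , inside  | _       = there (here refl)

    inner : Subset n → List (Subset n)
    inner a = List.map (λ β → attach β a) (trail a)

    block : Subset n → List (Subset n)
    block a = List.map (λ β → attach β a) (route a)

    block-path : ∀ {a} → Dominates A″ W″ a →
                 Path (TARSAdj G) (attach (inside , inside) a) (inner a) (attach (outside , inside) a)
    block-path {a} _ with dominates? A″ W a | pairCovered? a
    ... | yes _ | yes _ = toggle-y inside a ∷ toggle-x outside a ∷ TARSAdj-sym G (toggle-y outside a) ∷ []
    ... | yes _ | no _  = toggle-y inside a ∷ slide-x→y a ∷ []
    ... | no _  | _     = toggle-x inside a ∷ []

    block-unique : ∀ {a} → Dominates A″ W″ a → Unique (block a)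
    block-unique {a} (a⊆A″ , _) = Unique.map⁺ (proj₁ ∘ attach-injective a⊆A″ a⊆A″) (route-unique a)

    block-sound : ∀ {a} → Dominates A″ W″ a → All (Dominates A W) (block a)
    block-sound dom = All.tabulate λ m →
      let β , β∈ , eq = ∈-map⁻ _ m in
      subst (Dominates A W) (sym eq) (attach-dominates β (∈-route⇒admissible dom β∈))

    block-core : ∀ {a S} → Dominates A″ W″ a → S List.∈ block a → detach S ≡ a
    block-core (a⊆A″ , _) m with β , _ , refl ← ∈-map⁻ _ m = detach-attach β a⊆A″

    block-complete : ∀ {S} → Dominates A W S →
                     Dominates A″ W″ (detach S) × S List.∈ block (detach S)
    block-complete {S} dom = detach-dominates″ dom ,
      subst (List._∈ block (detach S)) (attach-detach S)
        (∈-map⁺ (λ β → attach β (detach S)) (admissible⇒∈-route (bits S) (detach-admissible dom)))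

    lift : ∀ β {a a′} → Dominates A″ W″ a → Dominates A″ W″ a′ → TARSAdj G a a′ →
           TARSAdj G (attach β a) (attach β a′)
    lift β (a⊆A″ , _) (a′⊆A″ , _) = attach-lift β a⊆A″ a′⊆A″

    extend : HamPath A″ W″ → HamPath A W
    extend H = subst (HamiltonianPath (TARSAdj G) (Dominates A W)) attach-detach-A
      (Snake.hamiltonianPath (TARSAdj-sym G) (attach (inside , inside)) (attach (outside , inside)) inner detach
        block-path (lift (inside , inside)) (lift (outside , inside))
        block-unique block-sound block-core block-complete H)
      where
      attach-detach-A : attach (inside , inside) A″ ≡ A
      attach-detach-A =
        trans (cong (λ β → attach β A″) (sym (cong₂ _,_ ([]=⇒lookup x∈A) ([]=⇒lookup y∈A))))
                              (attach-detach A)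

  emptyPath : ∀ {A W} → Empty A → HamPath A W
  emptyPath {A} empty = record
    { rest     = []
    ; end      = A
    ; path     = []
    ; unique   = [] ∷ []
    ; sound    = ((λ v∈ → v∈) , λ v v∈A _ _ → contradiction (v , v∈A) empty) ∷ []
    ; complete = λ (S⊆A , _) →
        here (trans (Empty-unique λ (v , v∈S) → empty (v , S⊆A v∈S)) (sym (Empty-unique empty)))
    }

  hamiltonianPath : IsForest G → ∀ A W → HamPath A W
  hamiltonianPath forest A = go A (⊂-wellFounded A)
    where
    go : ∀ A → Acc _⊂_ A → ∀ W → HamPath A W
    go A (acc smaller) W with nonempty? A
    ... | no empty = emptyPath empty
    ... | yes nonempty
      with x , x∈A , atMostOne ← forest⇒atMostOneNeighbour G forest A nonempty
      with any? (λ y → (y ∈? A) ×-dec adj? x y)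
    ... | no isolated = Isolated.extend x∈A (λ y∈A xy → isolated (_ , y∈A , xy))
                          (go _ (smaller (x∈p⇒p[x]≔outside⊂p x∈A)) W)
    ... | yes (y , y∈A , xy) with acc smaller′ ← smaller (x∈p⇒p[x]≔outside⊂p x∈A) =
      Leaf.extend x∈A y∈A xy (λ z∈A xz → atMostOne z∈A y∈A xz xy)
        (go _ (smaller′ (x∈p⇒p[x]≔outside⊂p (x∈p∧x≢y⇒x∈p[y]≔b y∈A (Adj⇒≢ G (Adj-sym xy))))) _)

allSubsets-unique : ∀ k → Unique (allSubsets k)
allSubsets-unique zero    = [] ∷ []
allSubsets-unique (suc k) = Unique.++⁺ (Unique.map⁺ ∷-injectiveʳ (allSubsets-unique k))
                                       (Unique.map⁺ ∷-injectiveʳ (allSubsets-unique k)) disjoint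
  where
  disjoint : ∀ {S} → ¬ (S List.∈ List.map (true ∷_) (allSubsets k) ×
                        S List.∈ List.map (false ∷_) (allSubsets k))
  disjoint (m₁ , m₂) with _ , _ , refl ← ∈-map⁻ _ m₁ with _ , _ , () ← ∈-map⁻ _ m₂

numDominating≤ : ∀ G {L : List (Subset (Graph.n G))} → (∀ {S} → Dominating G S → S List.∈ L) →
                 numDominating G ≤ length L
numDominating≤ G covers = Unique∧⊆⇒length≤ (Unique.filter⁺ (dominating? G) (allSubsets-unique _))
  λ m → covers (proj₂ (∈-filter⁻ (dominating? G) {xs = allSubsets _} m))

module _ (G : Graph) where
  open Graph G renaming (sym to Adj-sym)

  hasNeighbour? : ∀ v → Dec (∃ (Adj v))
  hasNeighbour? v = any? (adj? v)

  nonIsolated : Subset n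
  nonIsolated = subset hasNeighbour?

  edgeless⇒numDominating≤1 : Empty nonIsolated → numDominating G ≤ 1
  edgeless⇒numDominating≤1 empty = numDominating≤ G only-⊤
    where
    only-⊤ : ∀ {S} → Dominating G S → S List.∈ Subset.⊤ ∷ []
    only-⊤ {S} dom = here (⊆-antisym ⊆⊤ ⊤⊆S)
      where
      ⊤⊆S : Subset.⊤ ⊆ S
      ⊤⊆S {v} _ with v ∈? S
      ... | yes v∈S = v∈S
      ... | no v∉S with u , _ , uv ← dom v v∉S =
        contradiction (v , ∈-subset⁺ hasNeighbour? (u , Adj-sym uv)) empty

  edgeless⇒pancyclic : Empty nonIsolated → TARSPancyclic G
  edgeless⇒pancyclic empty ℓ 3≤ℓ ℓ≤N with s≤s () ← ≤-trans 3≤ℓ (≤-trans ℓ≤N (edgeless⇒numDominating≤1 empty))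

  pendantEdge : IsForest G → Nonempty nonIsolated → ∃₂ λ x y → Adj x y × (∀ {z} → Adj x z → z ≡ y)
  pendantEdge forest nonempty
    with x , x∈ , atMostOne ← forest⇒atMostOneNeighbour G forest nonIsolated nonempty
    with y , xy ← ∈-subset⁻ hasNeighbour? x∈ =
    x , y , xy , λ xz →
      atMostOne (∈-subset⁺ hasNeighbour? (_ , Adj-sym xz)) (∈-subset⁺ hasNeighbour? (_ , Adj-sym xy)) xz xy

  module PendantEdge (forest : IsForest G) {x y : Fin n} (xy : Adj x y) (pendant : ∀ {z} → Adj x z → z ≡ y) where
    open Leaf G {Subset.⊤} {Subset.⊥} ∈⊤ ∈⊤ xy (λ _ → pendant)
    open Ladder (TARSAdj G) (TARSAdj-sym G)
      using (Vertex; row; apex; base; Edge; along; along-apex; rung; up; down; InLadder)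
    open HamiltonianPath

    rows : HamPath G A″ W″
    rows = hamiltonianPath G forest A″ W″

    apexes : HamPath G A″ Subset.⊥
    apexes = hamiltonianPath G forest A″ Subset.⊥

    L Z : List (Subset n)
    L = A″ ∷ rest rows
    Z = A″ ∷ rest apexes

    Z⊆L : ∀ {a} → a List.∈ Z → a List.∈ L
    Z⊆L a∈Z = complete rows (Dominates-mono G (⊆-min W″) (All.lookup (sound apexes) a∈Z))

    -- The rows consist of the dominating sets containing y, the apexes of those containing x but not y.
    embed : Vertex → Subset n
    embed (row s a) = attach (s , inside) a
    embed (apex a)  = attach (inside , outside) a

    core⊆A″ : ∀ v → InLadder L Z v → base v ⊆ A″
    core⊆A″ (row _ _) a∈L = proj₁ (All.lookup (sound rows) a∈L)
    core⊆A″ (apex _)  a∈Z = proj₁ (All.lookup (sound apexes) a∈Z)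

    embed-dominating : ∀ {v} → InLadder L Z v → Dominating G (embed v)
    embed-dominating {row s _} a∈L =
      dominates⇒dominating G (attach-dominates (s , inside) (All.lookup (sound rows) a∈L))
    embed-dominating {apex _}  a∈Z =
      dominates⇒dominating G (attach-dominates (inside , outside) (All.lookup (sound apexes) a∈Z))

    embed-injective : ∀ {u v} → InLadder L Z u → InLadder L Z v → embed u ≡ embed v → u ≡ v
    embed-injective {u} {v} p q = injective u v (core⊆A″ u p) (core⊆A″ v q)
      where
      injective : ∀ u v → base u ⊆ A″ → base v ⊆ A″ → embed u ≡ embed v → u ≡ v
      injective (row _ _) (row _ _) u⊆ v⊆ eq with refl , refl ← attach-injective u⊆ v⊆ eq = refl
      injective (apex _)  (apex _)  u⊆ v⊆ eq with refl , refl ← attach-injective u⊆ v⊆ eq = refl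
      injective (row _ _) (apex _)  u⊆ v⊆ eq with () , _ ← attach-injective u⊆ v⊆ eq
      injective (apex _)  (row _ _) u⊆ v⊆ eq with () , _ ← attach-injective u⊆ v⊆ eq

    embed-edge : ∀ {u v} → InLadder L Z u → InLadder L Z v → Edge u v → TARSAdj G (embed u) (embed v)
    embed-edge {u} {v} p q (along r)      = attach-lift _ (core⊆A″ u p) (core⊆A″ v q) r
    embed-edge {u} {v} p q (along-apex r) = attach-lift _ (core⊆A″ u p) (core⊆A″ v q) r
    embed-edge _ _ (rung {inside})  = toggle-x inside _
    embed-edge _ _ (rung {outside}) = TARSAdj-sym G (toggle-x inside _)
    embed-edge _ _ (up {inside})    = toggle-y inside _
    embed-edge _ _ (up {outside})   = TARSAdj-sym G (slide-x→y _)
    embed-edge _ _ (down {inside})  = TARSAdj-sym G (toggle-y inside _)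
    embed-edge _ _ (down {outside}) = slide-x→y _

    ladder : List Vertex
    ladder = List.map (row inside) L ++ List.map (row outside) L ++ List.map apex Z

    ladder-covers : ∀ {S} → Dominating G S → S List.∈ List.map embed ladder
    ladder-covers {S} dom with lookup S x | lookup S y | detach-admissible (dominating⇒dominates G dom) | attach-detach S
    ... | inside  | inside  | adm | S≡ = subst (List._∈ _) S≡ (∈-map⁺ embed
      (∈-++⁺ˡ (∈-map⁺ (row inside) (complete rows adm))))
    ... | outside | inside  | adm | S≡ = subst (List._∈ _) S≡ (∈-map⁺ embed
      (∈-++⁺ʳ (List.map (row inside) L) (∈-++⁺ˡ (∈-map⁺ (row outside) (complete rows adm)))))
    ... | inside  | outside | adm | S≡ = subst (List._∈ _) S≡ (∈-map⁺ embed
      (∈-++⁺ʳ (List.map (row inside) L) (∈-++⁺ʳ (List.map (row outside) L)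
        (∈-map⁺ apex (complete apexes adm)))))
    ... | outside | outside | (_ , x∈⊥ , _) | _ = contradiction x∈⊥ ∉⊥

    length-ladder : length (List.map embed ladder) ≡ length L + length L + length Z
    length-ladder = begin
      length (List.map embed ladder)                                       ≡⟨ length-map embed ladder ⟩
      length ladder                                                        ≡⟨ length-++ (List.map (row inside) L) ⟩
      length (List.map (row inside) L) + length (List.map (row outside) L ++ List.map apex Z)
        ≡⟨ cong (length (List.map (row inside) L) +_) (length-++ (List.map (row outside) L)) ⟩
      length (List.map (row inside) L) + (length (List.map (row outside) L) + length (List.map apex Z))
        ≡⟨ cong₂ _+_ (length-map _ L) (cong₂ _+_ (length-map _ L) (length-map apex Z)) ⟩
      length L + (length L + length Z)
        ≡⟨ +-assoc (length L) (length L) (length Z) ⟨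
      length L + length L + length Z                                       ∎
      where open ≡-Reasoning

    pancyclic : TARSPancyclic G
    pancyclic ℓ 3≤ℓ ℓ≤N = mapCycle embed embed-injective embed-dominating embed-edge
      (Ladder.pancyclic (TARSAdj G) (TARSAdj-sym G) (path rows) (unique rows) (path apexes) (unique apexes)
        Z⊆L ℓ 3≤ℓ (≤-trans ℓ≤N (subst (numDominating G ≤_) length-ladder
                                         (numDominating≤ G ladder-covers))))

mainTheorem7 : (F : Graph) → IsForest F → TARSPancyclic F
mainTheorem7 F forest with nonempty? (nonIsolated F)
... | no  edgeless = edgeless⇒pancyclic F edgeless
... | yes nonempty with x , y , xy , pendant ← pendantEdge F forest nonempty =
  PendantEdge.pancyclic F forest xy pendant
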